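{- For every integer $n>2$, the set $\mathrm{FC}(B_n)$ is not Poirier type $B$ Schur-positive.
   Context: $B_n$ is the group of signed permutations of $\{\pm1,\dots,\pm n\}$ (bijections with $w(-i)=-w(i)$), $w=[w_1,\dots,w_n]$. Generators: $s_0=[-1,2,\dots,n]$ and $s_i$ ($1\le i\le n-1$) swapping the values in positions $i,i+1$ of the identity; $w$ is fully commutative if any reduced (shortest) expression in the generators can be obtained from any other by repeatedly replacing a factor $s_is_j$ by $s_js_i$ with $|i-j|\ge2$; $\mathrm{FC}(B_n)$ is the set of such elements. Let $<_r$ be the total order $-1<_r-2<_r\cdots<_r-n<_r1<_r2<_r\cdots<_rn$, and $\mathrm{rDes}(w)=\{1\le i<n\mid w_i>_rw_{i+1}\}$, $\mathrm{Neg}(w)=\{i\mid w_i<0\}$. With variable sets $X=(x_1,x_2,\dots)$, $Y=(y_1,y_2,\dots)$, Poirier's function is $F^P_w(X,Y)=\sum z_{i_1}\cdots z_{i_n}$ over $1\le i_1\le\cdots\le i_n$ with $i_j<i_{j+1}$ for $j\in\mathrm{rDes}(w)$, where $z_{i_j}=y_{i_j}$ if $j\in\mathrm{Neg}(w)$ and $z_{i_j}=x_{i_j}$ otherwise. A subset $A\subseteq B_n$ is Poirier type $B$ Schur-positive if $\mathcal{Q}^P(A)=\sum_{w\in A}F^P_w(X,Y)$ is symmetric in $X$ and in $Y$ and is a non-negative combination of products $s_\lambda(X)s_\mu(Y)$ of Schur functions. -}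

module Defs where

open import Data.Bool using (Bool; true; false; _∧_; _∨_; not; if_then_else_)
open import Data.Nat using (ℕ; zero; suc; _+_; _*_; _≤_; _<_; _≡ᵇ_; _<ᵇ_; _≤ᵇ_; _⊔_)
open import Data.Integer using (ℤ; +_; -[1+_]; ∣_∣; -_)
open import Data.List using (List; []; _∷_; _++_; map; concatMap; upTo; length; filterᵇ; foldl)
open import Data.Nat.ListAction using (sum)
open import Data.List.Relation.Unary.All using (All)
open import Data.List.Relation.Unary.Linked using (Linked)
open import Data.List.Relation.Unary.Unique.Propositional using (Unique)
open import Data.List.Relation.Binary.Permutation.Propositional using (_↭_)
open import Data.List.Membership.Propositional using (_∈_)
open import Data.Product using (Σ; _×_; _,_)
open import Data.Sum using (_⊎_)
open import Function.Bundles using (_⇔_)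
open import Relation.Binary.PropositionalEquality using (_≡_)
open import Relation.Binary.Construct.Closure.ReflexiveTransitive using (Star)

-- Signed permutations in window notation  w = [w₁,…,wₙ]  (a list of integers)

IsSignedPerm : ℕ → List ℤ → Set
IsSignedPerm n w =
  length w ≡ n × All (λ a → 1 ≤ ∣ a ∣ × ∣ a ∣ ≤ n) w × Unique (map ∣_∣ w)

identity : ℕ → List ℤ
identity n = map (λ k → + suc k) (upTo n)

-- right action of a generator on a window (w ↦ w·sᵢ):
--   s₀ negates the value in position 1,
--   sᵢ (i ≥ 1) swaps the values in positions i, i+1 (0-based indices i-1, i).
negHead : List ℤ → List ℤ
negHead []      = []
negHead (a ∷ w) = (- a) ∷ w

swapAt : ℕ → List ℤ → List ℤ
swapAt zero    (a ∷ b ∷ w) = b ∷ a ∷ w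
swapAt zero    w           = w
swapAt (suc k) []          = []
swapAt (suc k) (a ∷ w)     = a ∷ swapAt k w

actGen : List ℤ → ℕ → List ℤ
actGen w zero    = negHead w
actGen w (suc k) = swapAt k w

evalWord : ℕ → List ℕ → List ℤ
evalWord n s = foldl actGen (identity n) s

IsWord : ℕ → List ℕ → Set
IsWord n s = All (λ i → i < n) s

IsReduced : ℕ → List ℤ → List ℕ → Set
IsReduced n w s =
  IsWord n s × evalWord n s ≡ w ×
  (∀ t → IsWord n t → evalWord n t ≡ w → length s ≤ length t)

data CommStep : List ℕ → List ℕ → Set where
  comm : ∀ u v i j → (2 + i ≤ j ⊎ 2 + j ≤ i) →
         CommStep (u ++ i ∷ j ∷ v) (u ++ j ∷ i ∷ v)

IsFC : ℕ → List ℤ → Set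
IsFC n w =
  IsSignedPerm n w ×
  (∀ s t → IsReduced n w s → IsReduced n w t → Star CommStep s t)

-- Formal power series in X = (x₁,x₂,…), Y = (y₁,y₂,…) with ℕ coefficients,
-- given by their coefficient functions.  A monomial x^α y^β is given by two
-- finite exponent lists α, β (α = [α₁,…,α_k] means x₁^α₁⋯x_k^α_k, all later
-- exponents 0).  Variable xᵥ (1-based) corresponds to list index v-1.

Series : Set
Series = List ℕ → List ℕ → ℕ

lookupD : List ℕ → ℕ → ℕ
lookupD []      _       = 0
lookupD (a ∷ _) zero    = a
lookupD (_ ∷ α) (suc v) = lookupD α v

count : {A : Set} → (A → Bool) → List A → ℕ
count p xs = length (filterᵇ p xs)

allB : {A : Set} → (A → Bool) → List A → Bool
allB p []       = true
allB p (x ∷ xs) = p x ∧ allB p xs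

seqs : ℕ → ℕ → List (List ℕ)
seqs m zero    = [] ∷ []
seqs m (suc k) = concatMap (λ i → map (i ∷_) (seqs m k)) (upTo m)

isNeg : ℤ → Bool
isNeg -[1+ _ ] = true
isNeg (+ _)    = false

-- a <_r b  for the order  -1 <_r -2 <_r ⋯ <_r -n <_r 1 <_r ⋯ <_r n
ltR : ℤ → ℤ → Bool
ltR a b with isNeg a | isNeg b
... | true  | false = true
... | false | true  = false
... | _     | _     = ∣ a ∣ <ᵇ ∣ b ∣

-- i₁ ≤ i₂ ≤ ⋯ ≤ iₙ with i_j < i_{j+1} whenever j ∈ rDes(w)  (w_j >_r w_{j+1})
admissible : List ℤ → List ℕ → Bool
admissible (a ∷ b ∷ w) (i ∷ j ∷ is) =
  (if ltR b a then i <ᵇ j else i ≤ᵇ j) ∧ admissible (b ∷ w) (j ∷ is)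
admissible _ _ = true

-- exponent of x_{v+1} (neg = false) or y_{v+1} (neg = true) in z_{i₁}⋯z_{iₙ}
expo : Bool → ℕ → List ℤ → List ℕ → ℕ
expo neg v (a ∷ w) (i ∷ is) =
  (if (isNeg a ∧ neg) ∨ (not (isNeg a) ∧ not neg)
     then (if i ≡ᵇ v then 1 else 0) else 0) + expo neg v w is
expo neg v _ _ = 0

-- coefficient of x^α y^β in F^P_w(X,Y)
FP : List ℤ → Series
FP w α β = count ok (seqs m (length w))
  where
  m = length α ⊔ length β
  ok : List ℕ → Bool
  ok is = admissible w is ∧
          allB (λ v → (expo false v w is ≡ᵇ lookupD α v) ∧
                      (expo true  v w is ≡ᵇ lookupD β v)) (upTo m)

-- Q^P(A) for a finite set A given as a duplicate-free list
QP : List (List ℤ) → Series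
QP A α β = sum (map (λ w → FP w α β) A)

IsPartition : List ℕ → Set
IsPartition λ′ = All (λ r → 1 ≤ r) λ′ × Linked (λ a b → b ≤ a) λ′

weakInc : List ℕ → Bool
weakInc (a ∷ b ∷ r) = (a ≤ᵇ b) ∧ weakInc (b ∷ r)
weakInc _ = true

tabs : ℕ → List ℕ → List (List (List ℕ))
tabs m []        = [] ∷ []
tabs m (r ∷ λ′) =
  concatMap (λ row → map (row ∷_) (tabs m λ′)) (filterᵇ weakInc (seqs m r))

colPair : List ℕ → List ℕ → Bool
colPair (a ∷ r) (b ∷ s) = (a <ᵇ b) ∧ colPair r s
colPair []      (_ ∷ _) = false
colPair _       []      = true

colStrict : List (List ℕ) → Bool
colStrict (r ∷ s ∷ t) = colPair r s ∧ colStrict (s ∷ t)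
colStrict _ = true

occ : ℕ → List (List ℕ) → ℕ
occ v t = sum (map (λ row → count (λ a → a ≡ᵇ v) row) t)

-- coefficient of x^α in s_λ(X): number of SSYT of shape λ and content α
kostka : List ℕ → List ℕ → ℕ
kostka λ′ α = count ok (tabs (length α) λ′)
  where
  ok : List (List ℕ) → Bool
  ok t = colStrict t ∧ allB (λ v → occ v t ≡ᵇ lookupD α v) (upTo (length α))

SymmetricX : Series → Set
SymmetricX Q = ∀ α α′ β → α ↭ α′ → Q α β ≡ Q α′ β

SymmetricY : Series → Set
SymmetricY Q = ∀ α β β′ → β ↭ β′ → Q α β ≡ Q α β′

SchurPositiveXY : Series → Set
SchurPositiveXY Q =
  Σ (List (ℕ × List ℕ × List ℕ)) λ cs →
    All (λ { (c , l , m) → IsPartition l × IsPartition m }) cs ×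
    (∀ α β → Q α β ≡ sum (map (λ { (c , l , m) → c * kostka l α * kostka m β }) cs))

PoirierSchurPositive : List (List ℤ) → Set
PoirierSchurPositive A = SymmetricX (QP A) × SymmetricY (QP A) × SchurPositiveXY (QP A)

EnumeratesFC : ℕ → List (List ℤ) → Set
EnumeratesFC n L = Unique L × (∀ w → (w ∈ L) ⇔ IsFC n w)

-- The coefficients of x₁^{m+1} x₂ y₁ and of x₁^{m+1} x₂ y₃ in Q^P(FC(B_{m+3})) differ, so Q^P is not
-- symmetric in Y. A signed permutation w contributes at most 1 to the second coefficient, and only if
-- w = P q r with P non-negative and without r-descents, q > 0 > r; full commutativity excludes a consecutive
-- pattern p > q > r, so P q is increasing and the rotation r P q is again fully commutative (it has a unique
-- reduced word) and contributes to the first coefficient. Rotation is injective and misses the fully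
-- commutative element e = [-1, 2, …, m+1, m+3, m+2], which contributes to the first coefficient as well.

module Submission where

open import Defs
open import Data.Bool using (Bool; true; false; T; _∧_; _∨_; not; if_then_else_)
open import Data.Empty using (⊥; ⊥-elim)
open import Data.Integer as ℤ using (ℤ; +_; -[1+_]; ∣_∣; -_; +<+; -<+; -<-)
import Data.Integer.Properties as ℤP
open import Data.List
  using (List; []; _∷_; _++_; _∷ʳ_; map; length; foldl; filter; upTo; applyUpTo; replicate; reverse; initLast; _∷ʳ′_)
import Data.List.Properties as ListP
open import Data.List.Membership.Propositional using (_∈_)
import Data.List.Membership.Propositional.Properties as ∈P
open import Data.List.Relation.Binary.Permutation.Propositional as ↭ using (_↭_; ↭⇒↭ₛ)
import Data.List.Relation.Binary.Permutation.Propositional.Properties as ↭P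
import Data.List.Relation.Binary.Permutation.Setoid.Properties as ↭ₛP
open import Data.List.Relation.Binary.Subset.Propositional using (_⊆_)
open import Data.List.Relation.Unary.All as All using (All; []; _∷_)
import Data.List.Relation.Unary.All.Properties as AllP
open import Data.List.Relation.Unary.AllPairs as AllPairs using (AllPairs; []; _∷_)
import Data.List.Relation.Unary.AllPairs.Properties as AllPairsP
open import Data.List.Relation.Unary.Any using (here; there)
open import Data.List.Relation.Unary.Linked as Linked using (Linked; []; [-]; _∷_)
import Data.List.Relation.Unary.Linked.Properties as LinkedP
open import Data.List.Relation.Unary.Unique.Propositional using (Unique)
import Data.List.Relation.Unary.Unique.Propositional.Properties as UniqueP
open import Data.Nat as ℕ using (ℕ; zero; suc; _+_; _≤_; _<_; z≤n; s≤s; _≡ᵇ_; _<ᵇ_; _≤ᵇ_)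
import Data.Nat.Properties as ℕP
open import Data.Nat.ListAction using (sum)
open import Data.Nat.Tactic.RingSolver using (solve-∀)
open import Data.Product using (∃; _×_; _,_; proj₁; proj₂)
open import Data.Sum using (_⊎_; inj₁; inj₂)
open import Data.Unit using (⊤; tt)
open import Function.Bundles using (Equivalence)
open import Relation.Binary.Construct.Closure.ReflexiveTransitive using (Star; ε; _◅_)
open import Relation.Binary.Definitions using (tri<; tri≈; tri>)
open import Relation.Binary.PropositionalEquality
open import Relation.Nullary using (Dec; yes; no; ¬_; does)
open import Relation.Nullary.Decidable using (_⊎-dec_)

∧-true : ∀ x {y} → x ∧ y ≡ true → x ≡ true × y ≡ true
∧-true true {true} _ = refl , refl

≡ᵇ-true : ∀ {x y} → (x ≡ᵇ y) ≡ true → x ≡ y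
≡ᵇ-true {x} {y} e = ℕP.≡ᵇ⇒≡ x y (subst T (sym e) _)

≡⇒≡ᵇ-true : ∀ {x y} → x ≡ y → (x ≡ᵇ y) ≡ true
≡⇒≡ᵇ-true {x} refl = T-true (ℕP.≡⇒≡ᵇ x x refl)
  where
  T-true : ∀ {b} → T b → b ≡ true
  T-true {true} _ = refl

Linked-head : ∀ {A : Set} {R : A → A → Set} → (∀ {x y z} → R x y → R y z → R x z) →
              ∀ {a w} → Linked R (a ∷ w) → All (R a) w
Linked-head tr [-]     = []
Linked-head tr (r ∷ l) = LinkedP.Linked⇒All tr r l

Linked-∷ʳ : ∀ {A : Set} {R : A → A → Set} {xs y} → Linked R xs → All (λ a → R a y) xs → Linked R (xs ∷ʳ y)
Linked-∷ʳ {xs = []}          _         _           = [-]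
Linked-∷ʳ {xs = x ∷ []}      _         (r ∷ [])    = r ∷ [-]
Linked-∷ʳ {xs = x ∷ x′ ∷ xs} (r ∷ inc) (_ ∷ rs)    = r ∷ Linked-∷ʳ inc rs

Linked-∷ʳ⁺ : ∀ {A : Set} {R : A → A → Set} xs {p q} → Linked R (xs ∷ʳ p) → R p q → Linked R (xs ∷ʳ p ∷ʳ q)
Linked-∷ʳ⁺ []           _         rpq = rpq ∷ [-]
Linked-∷ʳ⁺ (x ∷ [])     (r ∷ _)   rpq = r ∷ rpq ∷ [-]
Linked-∷ʳ⁺ (x ∷ y ∷ xs) (r ∷ inc) rpq = r ∷ Linked-∷ʳ⁺ (y ∷ xs) inc rpq

Linked-last : ∀ {A : Set} {R : A → A → Set} xs {a b} → Linked R (xs ++ a ∷ b ∷ []) → R a b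
Linked-last []       (r ∷ _) = r
Linked-last (x ∷ xs) inc     = Linked-last xs (Linked.tail inc)

AllPairs-++⁻ˡ : ∀ {A : Set} {R : A → A → Set} xs {ys} → AllPairs R (xs ++ ys) → AllPairs R xs
AllPairs-++⁻ˡ []       _          = []
AllPairs-++⁻ˡ (x ∷ xs) (rx ∷ rxs) = AllP.++⁻ˡ xs rx ∷ AllPairs-++⁻ˡ xs rxs

AllPairs-++⁻ʳ : ∀ {A : Set} {R : A → A → Set} xs {ys} → AllPairs R (xs ++ ys) → AllPairs R ys
AllPairs-++⁻ʳ []       rys        = rys
AllPairs-++⁻ʳ (x ∷ xs) (_ ∷ rxs)  = AllPairs-++⁻ʳ xs rxs

filter-swap : ∀ {A : Set} {P : A → Set} (P? : ∀ x → Dec (P x)) {a b} v → ¬ (P a × P b) →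
  filter P? (a ∷ b ∷ v) ≡ filter P? (b ∷ a ∷ v)
filter-swap P? {a} {b} v ¬both = swap (P? a) (P? b)
  where
  open ≡-Reasoning
  swap : Dec _ → Dec _ → filter P? (a ∷ b ∷ v) ≡ filter P? (b ∷ a ∷ v)
  swap (yes pa) (yes pb) = ⊥-elim (¬both (pa , pb))
  swap (yes pa) (no ¬pb) = begin
    filter P? (a ∷ b ∷ v) ≡⟨ ListP.filter-accept P? pa ⟩
    a ∷ filter P? (b ∷ v) ≡⟨ cong (a ∷_) (ListP.filter-reject P? ¬pb) ⟩
    a ∷ filter P? v       ≡⟨ ListP.filter-accept P? pa ⟨
    filter P? (a ∷ v)     ≡⟨ ListP.filter-reject P? ¬pb ⟨
    filter P? (b ∷ a ∷ v) ∎
  swap (no ¬pa) (yes pb) = begin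
    filter P? (a ∷ b ∷ v) ≡⟨ ListP.filter-reject P? ¬pa ⟩
    filter P? (b ∷ v)     ≡⟨ ListP.filter-accept P? pb ⟩
    b ∷ filter P? v       ≡⟨ cong (b ∷_) (ListP.filter-reject P? ¬pa) ⟨
    b ∷ filter P? (a ∷ v) ≡⟨ ListP.filter-accept P? pb ⟨
    filter P? (b ∷ a ∷ v) ∎
  swap (no ¬pa) (no ¬pb) = begin
    filter P? (a ∷ b ∷ v) ≡⟨ ListP.filter-reject P? ¬pa ⟩
    filter P? (b ∷ v)     ≡⟨ ListP.filter-reject P? ¬pb ⟩
    filter P? v           ≡⟨ ListP.filter-reject P? ¬pa ⟨
    filter P? (a ∷ v)     ≡⟨ ListP.filter-reject P? ¬pb ⟨
    filter P? (b ∷ a ∷ v) ∎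

Unique-⊆⇒length≤ : ∀ {A : Set} {xs ys : List A} → Unique xs → xs ⊆ ys → length xs ≤ length ys
Unique-⊆⇒length≤ {xs = []}     _           _  = z≤n
Unique-⊆⇒length≤ {xs = x ∷ xs} (x∉xs ∷ u) xs⊆ys with ∈P.∈-∃++ (xs⊆ys (here refl))
... | ys₁ , ys₂ , refl = begin
  suc (length xs)               ≤⟨ s≤s (Unique-⊆⇒length≤ u xs⊆ys₁ys₂) ⟩
  suc (length (ys₁ ++ ys₂))     ≡⟨ cong suc (ListP.length-++ ys₁) ⟩
  suc (length ys₁ + length ys₂) ≡⟨ ℕP.+-suc (length ys₁) (length ys₂) ⟨
  length ys₁ + length (x ∷ ys₂) ≡⟨ ListP.length-++ ys₁ ⟨
  length (ys₁ ++ x ∷ ys₂)       ∎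
  where
  open ℕP.≤-Reasoning
  xs⊆ys₁ys₂ : xs ⊆ ys₁ ++ ys₂
  xs⊆ys₁ys₂ {z} z∈xs with ∈P.∈-++⁻ ys₁ (xs⊆ys (there z∈xs))
  ... | inj₁ z∈ys₁         = ∈P.∈-++⁺ˡ z∈ys₁
  ... | inj₂ (here refl)   = ⊥-elim (All.lookup x∉xs z∈xs refl)
  ... | inj₂ (there z∈ys₂) = ∈P.∈-++⁺ʳ ys₁ z∈ys₂

support : ∀ {A : Set} → (A → ℕ) → List A → List A
support f = filter (λ x → 1 ℕ.≤? f x)

sum-≤-length-support : ∀ {A : Set} (f : A → ℕ) L → (∀ x → x ∈ L → f x ≤ 1) →
  sum (map f L) ≤ length (support f L)
sum-≤-length-support f []      _   = z≤n
sum-≤-length-support f (x ∷ L) ≤1 = step (1 ℕ.≤? f x)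
  where
  ih = sum-≤-length-support f L (λ y y∈L → ≤1 y (there y∈L))
  step : Dec (1 ≤ f x) → sum (map f (x ∷ L)) ≤ length (support f (x ∷ L))
  step (yes 1≤fx) = ℕP.≤-trans (ℕP.+-mono-≤ (≤1 x (here refl)) ih)
                      (ℕP.≤-reflexive (cong length (sym (ListP.filter-accept (λ y → 1 ℕ.≤? f y) 1≤fx))))
  step (no 1≰fx)  = ℕP.≤-trans (ℕP.+-mono-≤ (ℕP.≤-pred (ℕP.≰⇒> 1≰fx)) ih)
                      (ℕP.≤-reflexive (cong length (sym (ListP.filter-reject (λ y → 1 ℕ.≤? f y) 1≰fx))))

length-support-≤-sum : ∀ {A : Set} (f : A → ℕ) L → length (support f L) ≤ sum (map f L)
length-support-≤-sum f []      = z≤n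
length-support-≤-sum f (x ∷ L) = step (1 ℕ.≤? f x)
  where
  ih = length-support-≤-sum f L
  step : Dec (1 ≤ f x) → length (support f (x ∷ L)) ≤ sum (map f (x ∷ L))
  step (yes 1≤fx) = ℕP.≤-trans (ℕP.≤-reflexive (cong length (ListP.filter-accept (λ y → 1 ℕ.≤? f y) 1≤fx)))
                      (ℕP.+-mono-≤ 1≤fx ih)
  step (no 1≰fx)  = ℕP.≤-trans (ℕP.≤-reflexive (cong length (ListP.filter-reject (λ y → 1 ℕ.≤? f y) 1≰fx)))
                      (ℕP.≤-trans ih (ℕP.m≤n+m _ (f x)))

sum-<-by-injection : ∀ {A : Set} (f g : A → ℕ) (r : A → A) (e : A) L → Unique L →
  (∀ x → x ∈ L → f x ≤ 1) → (∀ {x y} → r x ≡ r y → x ≡ y) →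
  (∀ x → x ∈ L → 1 ≤ f x → r x ∈ L × 1 ≤ g (r x) × r x ≢ e) → e ∈ L → 1 ≤ g e →
  suc (sum (map f L)) ≤ sum (map g L)
sum-<-by-injection f g r e L unique f≤1 r-injective image e∈L 1≤ge = begin
  suc (sum (map f L))              ≤⟨ s≤s (sum-≤-length-support f L f≤1) ⟩
  suc (length (support f L))       ≡⟨ cong suc (ListP.length-map r (support f L)) ⟨
  length (e ∷ map r (support f L)) ≤⟨ Unique-⊆⇒length≤ image-unique image⊆ ⟩
  length (support g L)             ≤⟨ length-support-≤-sum g L ⟩
  sum (map g L)                    ∎
  where
  open ℕP.≤-Reasoning
  image′ : ∀ {x} → x ∈ support f L → r x ∈ L × 1 ≤ g (r x) × r x ≢ e
  image′ x∈ = let x∈L , 1≤fx = ∈P.∈-filter⁻ (λ y → 1 ℕ.≤? f y) x∈ in image _ x∈L 1≤fx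
  image-unique : Unique (e ∷ map r (support f L))
  image-unique = All.tabulate e∉ ∷ UniqueP.map⁺ r-injective (UniqueP.filter⁺ (λ y → 1 ℕ.≤? f y) unique)
    where
    e∉ : ∀ {z} → z ∈ map r (support f L) → e ≢ z
    e∉ z∈ e≡z with ∈P.∈-map⁻ r z∈
    ... | x , x∈ , refl = proj₂ (proj₂ (image′ x∈)) (sym e≡z)
  image⊆ : e ∷ map r (support f L) ⊆ support g L
  image⊆ (here refl) = ∈P.∈-filter⁺ (λ y → 1 ℕ.≤? g y) e∈L 1≤ge
  image⊆ (there z∈) with ∈P.∈-map⁻ r z∈
  ... | x , x∈ , refl = ∈P.∈-filter⁺ (λ y → 1 ℕ.≤? g y) (proj₁ (image′ x∈)) (proj₁ (proj₂ (image′ x∈)))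

count-zero : ∀ {A : Set} (p : A → Bool) xs → (∀ x → x ∈ xs → p x ≢ true) → count p xs ≡ 0
count-zero p []       _      = refl
count-zero p (x ∷ xs) ¬p with p x in px
... | true  = ⊥-elim (¬p x (here refl) px)
... | false = count-zero p xs (λ y y∈xs → ¬p y (there y∈xs))

count-≤1 : ∀ {A : Set} (p : A → Bool) (c : A) xs → Unique xs → (∀ x → x ∈ xs → p x ≡ true → x ≡ c) →
  count p xs ≤ 1
count-≤1 p c []       _          _    = z≤n
count-≤1 p c (x ∷ xs) (x∉xs ∷ u) only with p x in px
... | true  = s≤s (ℕP.≤-reflexive (count-zero p xs λ y y∈xs py →
                All.lookup x∉xs y∈xs (trans (only x (here refl) px) (sym (only y (there y∈xs) py)))))
... | false = count-≤1 p c xs u (λ y y∈xs → only y (there y∈xs))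

count-≥1 : ∀ {A : Set} (p : A → Bool) {x} xs → x ∈ xs → p x ≡ true → 1 ≤ count p xs
count-≥1 p (y ∷ xs) (here refl) px rewrite px = s≤s z≤n
count-≥1 p (y ∷ xs) (there x∈xs) px with p y
... | true  = s≤s z≤n
... | false = count-≥1 p xs x∈xs px

count-≥1⇒witness : ∀ {A : Set} (p : A → Bool) xs → 1 ≤ count p xs → ∃ λ x → x ∈ xs × p x ≡ true
count-≥1⇒witness p (x ∷ xs) 1≤ with p x in px
... | true  = x , here refl , px
... | false with count-≥1⇒witness p xs 1≤
...   | y , y∈xs , py = y , there y∈xs , py

range : ℕ → ℕ → List ℕ
range a zero    = []
range a (suc L) = a ∷ range (suc a) L

range-∷ʳ : ∀ a L → range a (suc L) ≡ range a L ∷ʳ (a + L)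
range-∷ʳ a zero    = cong (_∷ []) (sym (ℕP.+-identityʳ a))
range-∷ʳ a (suc L) =
  cong (a ∷_) (trans (range-∷ʳ (suc a) L) (cong (λ z → range (suc a) L ∷ʳ z) (sym (ℕP.+-suc a L))))

range-increasing : ∀ a L → Linked _<_ (range a L)
range-increasing a zero          = []
range-increasing a (suc zero)    = [-]
range-increasing a (suc (suc L)) = ℕP.≤-refl ∷ range-increasing (suc a) (suc L)

increasing-bounded⇒length+≤ : ∀ ys b c → b ≤ c → All (b ≤_) ys → All (_< c) ys → Linked _<_ ys → length ys + b ≤ c
increasing-bounded⇒length+≤ []       b c b≤c _          _          _   = b≤c
increasing-bounded⇒length+≤ (y ∷ ys) b c b≤c (b≤y ∷ _) (y<c ∷ <c) inc = begin
  suc (length ys + b) ≤⟨ s≤s (ℕP.+-monoʳ-≤ (length ys) b≤y) ⟩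
  suc (length ys + y) ≡⟨ ℕP.+-suc (length ys) y ⟨
  length ys + suc y   ≤⟨ increasing-bounded⇒length+≤ ys (suc y) c y<c
                           (Linked-head ℕP.<-trans inc) <c (Linked.tail inc) ⟩
  c                   ∎
  where open ℕP.≤-Reasoning

increasing-bounded⇒range : ∀ ns L a → length ns ≡ L → All (a ≤_) ns → All (_< a + L) ns →
  Linked _<_ ns → ns ≡ range a L
increasing-bounded⇒range []       zero    a _   _          _          _   = refl
increasing-bounded⇒range (x ∷ ns) (suc L) a len (a≤x ∷ a≤) (x<  ∷ <c) inc =
  cong₂ _∷_ x≡a (increasing-bounded⇒range ns L (suc a) lenns
                   (subst (λ z → All (z <_) ns) x≡a (Linked-head ℕP.<-trans inc))
                   (subst (λ z → All (_< z) ns) (ℕP.+-suc a L) <c) (Linked.tail inc))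
  where
  lenns : length ns ≡ L
  lenns = ℕP.suc-injective len
  x≤a : x ≤ a
  x≤a = ℕP.+-cancelˡ-≤ L x a (ℕP.≤-pred (begin
    suc (L + x)        ≡⟨ ℕP.+-suc L x ⟨
    L + suc x          ≡⟨ cong (_+ suc x) lenns ⟨
    length ns + suc x  ≤⟨ increasing-bounded⇒length+≤ ns (suc x) (a + suc L) x<
                            (Linked-head ℕP.<-trans inc) <c (Linked.tail inc) ⟩
    a + suc L          ≡⟨ ℕP.+-suc a L ⟩
    suc (a + L)        ≡⟨ cong suc (ℕP.+-comm a L) ⟩
    suc (L + a)        ∎))
    where open ℕP.≤-Reasoning
  x≡a : x ≡ a
  x≡a = ℕP.≤-antisym x≤a a≤x

multiplicity : ℕ → List ℕ → ℕ
multiplicity v []      = 0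
multiplicity v (i ∷ σ) = (if i ≡ᵇ v then 1 else 0) + multiplicity v σ

multiplicity-absent : ∀ v σ → All (_≢ v) σ → multiplicity v σ ≡ 0
multiplicity-absent v []      []          = refl
multiplicity-absent v (i ∷ σ) (i≢v ∷ ≢v) with i ≡ᵇ v in i≡ᵇv
... | true  = ⊥-elim (i≢v (≡ᵇ-true i≡ᵇv))
... | false = multiplicity-absent v σ ≢v

multiplicity-head : ∀ x σ → multiplicity x (x ∷ σ) ≡ suc (multiplicity x σ)
multiplicity-head x σ rewrite ≡⇒≡ᵇ-true {x} refl = refl

multiplicity-below-sorted : ∀ {x y τ} → x < y → Linked _≤_ (y ∷ τ) → multiplicity x (y ∷ τ) ≡ 0
multiplicity-below-sorted x<y sorted = multiplicity-absent _ _
  (All.map (λ y≤z z≡x → ℕP.<-irrefl (sym z≡x) (ℕP.<-≤-trans x<y y≤z)) (ℕP.≤-refl ∷ Linked-head ℕP.≤-trans sorted))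

sorted-unique : ∀ σ τ → Linked _≤_ σ → Linked _≤_ τ → (∀ v → multiplicity v σ ≡ multiplicity v τ) → σ ≡ τ
sorted-unique []      []      _  _  _    = refl
sorted-unique []      (y ∷ τ) _  _  same = ⊥-elim (ℕP.0≢1+n (trans (same y) (multiplicity-head y τ)))
sorted-unique (x ∷ σ) []      _  _  same = ⊥-elim (ℕP.0≢1+n (trans (sym (same x)) (multiplicity-head x σ)))
sorted-unique (x ∷ σ) (y ∷ τ) sσ sτ same with ℕP.<-cmp x y
... | tri< x<y _ _ =
  ⊥-elim (ℕP.0≢1+n (trans (sym (multiplicity-below-sorted x<y sτ)) (trans (sym (same x)) (multiplicity-head x σ))))
... | tri> _ _ y<x =
  ⊥-elim (ℕP.0≢1+n (trans (sym (multiplicity-below-sorted y<x sσ)) (trans (same y) (multiplicity-head y τ))))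
... | tri≈ _ refl _ = cong (x ∷_) (sorted-unique σ τ (Linked.tail sσ) (Linked.tail sτ)
                                     (λ v → ℕP.+-cancelˡ-≡ _ _ _ (same v)))

multiplicity-zeros : ∀ k r → multiplicity 0 (replicate k 0 ++ r) ≡ k + multiplicity 0 r
multiplicity-zeros zero    r = refl
multiplicity-zeros (suc k) r = cong suc (multiplicity-zeros k r)

multiplicity-suc-zeros : ∀ v k r → multiplicity (suc v) (replicate k 0 ++ r) ≡ multiplicity (suc v) r
multiplicity-suc-zeros v zero    r = refl
multiplicity-suc-zeros v (suc k) r = multiplicity-suc-zeros v k r

infix 5 _<ᶻᵇ_

_<ᶻᵇ_ : ℤ → ℤ → Bool
a <ᶻᵇ b = does (a ℤ.<? b)

<ᶻᵇ-true : ∀ {a b} → a ℤ.< b → a <ᶻᵇ b ≡ true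
<ᶻᵇ-true {a} {b} a<b with a ℤ.<? b
... | yes _   = refl
... | no a≮b  = ⊥-elim (a≮b a<b)

<ᶻᵇ-false : ∀ {a b} → ¬ (a ℤ.< b) → a <ᶻᵇ b ≡ false
<ᶻᵇ-false {a} {b} a≮b with a ℤ.<? b
... | yes a<b = ⊥-elim (a≮b a<b)
... | no _    = refl

<ᶻᵇ-true⇒< : ∀ {a b} → a <ᶻᵇ b ≡ true → a ℤ.< b
<ᶻᵇ-true⇒< {a} {b} e with a ℤ.<? b
... | yes a<b = a<b

<-neg-swap : ∀ a b → b ℤ.< - a → a ℤ.< - b
<-neg-swap (+ zero)  (+ zero)   (+<+ ())
<-neg-swap (+ zero)  (+ suc b)  (+<+ ())
<-neg-swap (+ suc a) (+ b)      ()
<-neg-swap (+ zero)  -[1+ b ]   _          = +<+ (s≤s z≤n)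
<-neg-swap (+ suc a) -[1+ b ]   (-<- b<a)  = +<+ (s≤s b<a)
<-neg-swap -[1+ a ]  (+ zero)   _          = -<+
<-neg-swap -[1+ a ]  (+ suc b)  (+<+ (s≤s b<a)) = -<- b<a
<-neg-swap -[1+ a ]  -[1+ b ]   _          = -<+

<ᶻᵇ-neg-swap : ∀ a b → b <ᶻᵇ - a ≡ a <ᶻᵇ - b
<ᶻᵇ-neg-swap a b with b ℤ.<? - a | a ℤ.<? - b
... | yes _ | yes _ = refl
... | yes p | no q  = ⊥-elim (q (<-neg-swap a b p))
... | no p  | yes q = ⊥-elim (p (<-neg-swap b a q))
... | no _  | no _  = refl

Pos : ℤ → Set
Pos a = + 0 ℤ.< a

positive-¬<-neg : ∀ {a b} → Pos a → Pos b → ¬ (b ℤ.< - a)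
positive-¬<-neg {+ zero}  {+ b} 0<0 _ _ = ℤP.<-irrefl refl 0<0
positive-¬<-neg {+ suc a} {+ b} _   _ ()

neg-negative : ∀ {a} → a ℤ.< + 0 → + 0 ℤ.< - a
neg-negative { -[1+ n ]} _        = +<+ (s≤s z≤n)
neg-negative {+ n}      (+<+ ())

nonNegative⇒positive : ∀ {a} → + 0 ℤ.≤ a → 1 ≤ ∣ a ∣ → Pos a
nonNegative⇒positive {+ suc k} _ _ = +<+ (s≤s z≤n)

¬isNeg⇒positive : ∀ {a} → isNeg a ≡ false → 1 ≤ ∣ a ∣ → Pos a
¬isNeg⇒positive {+ suc k} _ _ = +<+ (s≤s z≤n)

negative-isNeg : ∀ {a} → isNeg a ≡ true → a ℤ.< + 0
negative-isNeg { -[1+ k ]} _ = -<+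

isNeg-positive : ∀ {a} → Pos a → isNeg a ≡ false
isNeg-positive {+ n} _ = refl

≤-distinct⇒< : ∀ {w} → Linked ℤ._≤_ w → Unique (map ∣_∣ w) → Linked ℤ._<_ w
≤-distinct⇒< []          _               = []
≤-distinct⇒< [-]         _               = [-]
≤-distinct⇒< (a≤b ∷ inc) ((a≢b ∷ _) ∷ u) =
  ℤP.≤∧≢⇒< a≤b (λ a≡b → a≢b (cong ∣_∣ a≡b)) ∷ ≤-distinct⇒< inc u

map-abs-positive : ∀ {w} → All Pos w → map (λ k → + k) (map ∣_∣ w) ≡ w
map-abs-positive {[]}    []          = refl
map-abs-positive {a ∷ w} (0<a ∷ pos) = cong₂ _∷_ (ℤP.0≤i⇒+∣i∣≡i (ℤP.<⇒≤ 0<a)) (map-abs-positive pos)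

map-abs-increasing : ∀ {w} → All Pos w → Linked ℤ._<_ w → Linked _<_ (map ∣_∣ w)
map-abs-increasing {[]}                _       _               = []
map-abs-increasing {a ∷ []}            _       _               = [-]
map-abs-increasing {+ a ∷ + b ∷ w}     (_ ∷ pos) (+<+ a<b ∷ inc) = a<b ∷ map-abs-increasing pos inc

rangeℤ : ℕ → ℕ → List ℤ
rangeℤ a L = map (λ k → + k) (range a L)

rangeℤ-∷ʳ : ∀ a L → rangeℤ a (suc L) ≡ rangeℤ a L ∷ʳ + (a + L)
rangeℤ-∷ʳ a L = trans (cong (map (λ k → + k)) (range-∷ʳ a L)) (ListP.map-++ (λ k → + k) (range a L) _)

length-rangeℤ : ∀ a L → length (rangeℤ a L) ≡ L
length-rangeℤ a zero    = refl
length-rangeℤ a (suc L) = cong suc (length-rangeℤ (suc a) L)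

rangeℤ-< : ∀ a L → All (ℤ._< + (a + L)) (rangeℤ a L)
rangeℤ-< a zero    = []
rangeℤ-< a (suc L) = +<+ (ℕP.m<m+n a (s≤s z≤n)) ∷
  subst (λ z → All (ℤ._< + z) (rangeℤ (suc a) L)) (sym (ℕP.+-suc a L)) (rangeℤ-< (suc a) L)

rangeℤ-increasing : ∀ a L → Linked ℤ._<_ (rangeℤ a L)
rangeℤ-increasing a zero          = []
rangeℤ-increasing a (suc zero)    = [-]
rangeℤ-increasing a (suc (suc L)) = +<+ ℕP.≤-refl ∷ rangeℤ-increasing (suc a) (suc L)

rangeℤ-positive : ∀ a L → All Pos (rangeℤ (suc a) L)
rangeℤ-positive a zero    = []
rangeℤ-positive a (suc L) = +<+ (s≤s z≤n) ∷ rangeℤ-positive (suc a) L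

map-abs-rangeℤ : ∀ a L → map ∣_∣ (rangeℤ a L) ≡ range a L
map-abs-rangeℤ a L = trans (sym (ListP.map-∘ (range a L))) (ListP.map-id (range a L))

identity≡rangeℤ : ∀ n → identity n ≡ rangeℤ 1 n
identity≡rangeℤ n = go n (λ k → k) 0 (λ k → refl)
  where
  go : ∀ L (h : ℕ → ℕ) a → (∀ k → h k ≡ a + k) →
       map (λ k → + suc k) (applyUpTo h L) ≡ rangeℤ (suc a) L
  go zero    h a h≗ = refl
  go (suc L) h a h≗ =
    cong₂ _∷_ (cong (λ z → + suc z) (trans (h≗ 0) (ℕP.+-identityʳ a)))
              (go L (λ k → h (suc k)) (suc a) (λ k → trans (h≗ (suc k)) (ℕP.+-suc a k)))

-- The Coxeter length

χ : Bool → ℕ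
χ true  = 1
χ false = 0

χ≤1 : ∀ b → χ b ≤ 1
χ≤1 true  = s≤s z≤n
χ≤1 false = z≤n

-- ℓ-swap-head and ℓ-neg-head have the shape ℓ w + [ascent] ≡ ℓ (w sⱼ) + [descent]; these three lemmas
-- read off the effect of one generator on ℓ from such an equation.
exchange-≤ : ∀ {x y} c d → x + χ c ≡ y + χ d → y ≤ suc x
exchange-≤ {x} {y} c d e = begin
  y               ≤⟨ ℕP.m≤m+n y (χ d) ⟩
  y + χ d         ≡⟨ e ⟨
  x + χ c         ≤⟨ ℕP.+-monoʳ-≤ x (χ≤1 c) ⟩
  x + 1           ≡⟨ ℕP.+-comm x 1 ⟩
  suc x           ∎
  where open ℕP.≤-Reasoning

exchange-descent : ∀ {x y} c → x + χ c ≡ y + 1 → c ≡ false → x ≡ suc y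
exchange-descent {x} {y} c e refl = trans (sym (ℕP.+-identityʳ x)) (trans e (ℕP.+-comm y 1))

exchange-< : ∀ {x y} c d → x + χ c ≡ y + χ d → y < x → d ≡ true
exchange-< {x} {y} c true  e y<x = refl
exchange-< {x} {y} c false e y<x = ⊥-elim (ℕP.<-irrefl refl (begin-strict
  y       <⟨ y<x ⟩
  x       ≤⟨ ℕP.m≤m+n x (χ c) ⟩
  x + χ c ≡⟨ e ⟩
  y + 0   ≡⟨ ℕP.+-identityʳ y ⟩
  y       ∎))
  where open ℕP.≤-Reasoning

-- ℓ(w) = neg(w) + inv(w) + nsp(w) in window notation: the pair (wᵢ, wⱼ), i < j, counts once if
-- wᵢ > wⱼ and once more if wᵢ + wⱼ < 0.
pairInversions : ℤ → ℤ → ℕ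
pairInversions a b = χ (b <ᶻᵇ a) + χ (b <ᶻᵇ - a)

ℓ : List ℤ → ℕ
ℓ []      = 0
ℓ (a ∷ w) = χ (a <ᶻᵇ + 0) + sum (map (pairInversions a) w) + ℓ w

sum-map-swapAt : ∀ (f : ℤ → ℕ) k w → sum (map f (swapAt k w)) ≡ sum (map f w)
sum-map-swapAt f zero    []          = refl
sum-map-swapAt f zero    (a ∷ [])    = refl
sum-map-swapAt f zero    (a ∷ b ∷ w) = solve (f a) (f b) (sum (map f w))
  where
  solve : ∀ x y z → y + (x + z) ≡ x + (y + z)
  solve = solve-∀
sum-map-swapAt f (suc k) []          = refl
sum-map-swapAt f (suc k) (a ∷ w)     = cong (λ s → f a + s) (sum-map-swapAt f k w)

sum-map-cong : ∀ {f g : ℤ → ℕ} → (∀ b → f b ≡ g b) → ∀ w → sum (map f w) ≡ sum (map g w)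
sum-map-cong f≗g []      = refl
sum-map-cong f≗g (b ∷ w) = cong₂ _+_ (f≗g b) (sum-map-cong f≗g w)

pairInversions-neg : ∀ a b → pairInversions (- a) b ≡ pairInversions a b
pairInversions-neg a b rewrite ℤP.neg-involutive a = ℕP.+-comm (χ (b <ᶻᵇ - a)) (χ (b <ᶻᵇ a))

ℓ-swap-head : ∀ a b w → ℓ (a ∷ b ∷ w) + χ (a <ᶻᵇ b) ≡ ℓ (b ∷ a ∷ w) + χ (b <ᶻᵇ a)
ℓ-swap-head a b w rewrite <ᶻᵇ-neg-swap a b =
  solve (χ (a <ᶻᵇ + 0)) (χ (b <ᶻᵇ + 0)) (χ (a <ᶻᵇ - b))
        (sum (map (pairInversions a) w)) (sum (map (pairInversions b) w)) (ℓ w)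
        (χ (b <ᶻᵇ a)) (χ (a <ᶻᵇ b))
  where
  solve : ∀ A B N Sa Sb s x y →
    A + (x + N + Sa) + (B + Sb + s) + y ≡ B + (y + N + Sb) + (A + Sa + s) + x
  solve = solve-∀

ℓ-neg-head : ∀ a w → ℓ (a ∷ w) + χ (- a <ᶻᵇ + 0) ≡ ℓ (- a ∷ w) + χ (a <ᶻᵇ + 0)
ℓ-neg-head a w rewrite sum-map-cong (pairInversions-neg a) w =
  solve (χ (a <ᶻᵇ + 0)) (χ (- a <ᶻᵇ + 0)) (sum (map (pairInversions a) w)) (ℓ w)
  where
  solve : ∀ x y S s → x + S + s + y ≡ y + S + s + x
  solve = solve-∀

-- SwapDescent w k : the right descent of s_{k+1} (positions k, k+1, counted from 0);
-- Descent w j : the right descent of the generator s_j.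
SwapDescent : List ℤ → ℕ → Set
SwapDescent []          _       = ⊥
SwapDescent (a ∷ w)     (suc k) = SwapDescent w k
SwapDescent (a ∷ [])    zero    = ⊥
SwapDescent (a ∷ b ∷ w) zero    = b ℤ.< a

Descent : List ℤ → ℕ → Set
Descent w       (suc k) = SwapDescent w k
Descent []      zero    = ⊥
Descent (a ∷ w) zero    = a ℤ.< + 0

ℓ-swapAt-≤ : ∀ k w → ℓ (swapAt k w) ≤ suc (ℓ w)
ℓ-swapAt-≤ zero    []          = z≤n
ℓ-swapAt-≤ zero    (a ∷ [])    = ℕP.n≤1+n _
ℓ-swapAt-≤ zero    (a ∷ b ∷ w) = exchange-≤ (a <ᶻᵇ b) (b <ᶻᵇ a) (ℓ-swap-head a b w)
ℓ-swapAt-≤ (suc k) []          = z≤n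
ℓ-swapAt-≤ (suc k) (a ∷ w) rewrite sum-map-swapAt (pairInversions a) k w =
  ℕP.≤-trans (ℕP.+-monoʳ-≤ _ (ℓ-swapAt-≤ k w)) (ℕP.≤-reflexive (ℕP.+-suc _ (ℓ w)))

ℓ-swapAt-descent : ∀ k w → SwapDescent w k → ℓ w ≡ suc (ℓ (swapAt k w))
ℓ-swapAt-descent zero (a ∷ b ∷ w) b<a =
  exchange-descent (a <ᶻᵇ b)
    (trans (ℓ-swap-head a b w) (cong (λ c → ℓ (b ∷ a ∷ w) + χ c) (<ᶻᵇ-true b<a)))
    (<ᶻᵇ-false (ℤP.<-asym b<a))
ℓ-swapAt-descent (suc k) (a ∷ w) d rewrite sum-map-swapAt (pairInversions a) k w =
  trans (cong (λ s → S + s) (ℓ-swapAt-descent k w d)) (ℕP.+-suc S (ℓ (swapAt k w)))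
  where S = χ (a <ᶻᵇ + 0) + sum (map (pairInversions a) w)

ℓ-swapAt-<⇒descent : ∀ k w → ℓ (swapAt k w) < ℓ w → SwapDescent w k
ℓ-swapAt-<⇒descent zero    []          ℓ< = ⊥-elim (ℕP.<-irrefl refl ℓ<)
ℓ-swapAt-<⇒descent zero    (a ∷ [])    ℓ< = ⊥-elim (ℕP.<-irrefl refl ℓ<)
ℓ-swapAt-<⇒descent zero    (a ∷ b ∷ w) ℓ< =
  <ᶻᵇ-true⇒< (exchange-< (a <ᶻᵇ b) (b <ᶻᵇ a) (ℓ-swap-head a b w) ℓ<)
ℓ-swapAt-<⇒descent (suc k) []          ℓ< = ⊥-elim (ℕP.<-irrefl refl ℓ<)
ℓ-swapAt-<⇒descent (suc k) (a ∷ w)     ℓ< rewrite sum-map-swapAt (pairInversions a) k w =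
  ℓ-swapAt-<⇒descent k w (ℕP.+-cancelˡ-< _ _ _ ℓ<)

ℓ-negHead-≤ : ∀ w → ℓ (negHead w) ≤ suc (ℓ w)
ℓ-negHead-≤ []      = z≤n
ℓ-negHead-≤ (a ∷ w) = exchange-≤ (- a <ᶻᵇ + 0) (a <ᶻᵇ + 0) (ℓ-neg-head a w)

ℓ-negHead-descent : ∀ w → Descent w 0 → ℓ w ≡ suc (ℓ (negHead w))
ℓ-negHead-descent (a ∷ w) a<0 =
  exchange-descent (- a <ᶻᵇ + 0)
    (trans (ℓ-neg-head a w) (cong (λ c → ℓ (- a ∷ w) + χ c) (<ᶻᵇ-true a<0)))
    (<ᶻᵇ-false (ℤP.<-asym (neg-negative a<0)))

ℓ-negHead-<⇒descent : ∀ w → ℓ (negHead w) < ℓ w → Descent w 0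
ℓ-negHead-<⇒descent []      ℓ< = ⊥-elim (ℕP.<-irrefl refl ℓ<)
ℓ-negHead-<⇒descent (a ∷ w) ℓ< =
  <ᶻᵇ-true⇒< (exchange-< (- a <ᶻᵇ + 0) (a <ᶻᵇ + 0) (ℓ-neg-head a w) ℓ<)

ℓ-actGen-≤ : ∀ w j → ℓ (actGen w j) ≤ suc (ℓ w)
ℓ-actGen-≤ w zero    = ℓ-negHead-≤ w
ℓ-actGen-≤ w (suc k) = ℓ-swapAt-≤ k w

ℓ-actGen-descent : ∀ w j → Descent w j → ℓ w ≡ suc (ℓ (actGen w j))
ℓ-actGen-descent w zero    = ℓ-negHead-descent w
ℓ-actGen-descent w (suc k) = ℓ-swapAt-descent k w

ℓ-actGen-<⇒descent : ∀ w j → ℓ (actGen w j) < ℓ w → Descent w j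
ℓ-actGen-<⇒descent w zero    = ℓ-negHead-<⇒descent w
ℓ-actGen-<⇒descent w (suc k) = ℓ-swapAt-<⇒descent k w

swapAt-involutive : ∀ k w → swapAt k (swapAt k w) ≡ w
swapAt-involutive zero    []          = refl
swapAt-involutive zero    (a ∷ [])    = refl
swapAt-involutive zero    (a ∷ b ∷ w) = refl
swapAt-involutive (suc k) []          = refl
swapAt-involutive (suc k) (a ∷ w)     = cong (a ∷_) (swapAt-involutive k w)

actGen-involutive : ∀ w j → actGen (actGen w j) j ≡ w
actGen-involutive []      zero    = refl
actGen-involutive (a ∷ w) zero    = cong (_∷ w) (ℤP.neg-involutive a)
actGen-involutive w       (suc k) = swapAt-involutive k w

ℓ-≤-actGen : ∀ w j → ℓ w ≤ suc (ℓ (actGen w j))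
ℓ-≤-actGen w j = subst (λ v → ℓ v ≤ suc (ℓ (actGen w j))) (actGen-involutive w j) (ℓ-actGen-≤ (actGen w j) j)

ℓ-foldl-≤ : ∀ w t → ℓ (foldl actGen w t) ≤ ℓ w + length t
ℓ-foldl-≤ w []      = ℕP.m≤m+n (ℓ w) 0
ℓ-foldl-≤ w (j ∷ t) = begin
  ℓ (foldl actGen (actGen w j) t) ≤⟨ ℓ-foldl-≤ (actGen w j) t ⟩
  ℓ (actGen w j) + length t        ≤⟨ ℕP.+-monoˡ-≤ (length t) (ℓ-actGen-≤ w j) ⟩
  suc (ℓ w) + length t             ≡⟨ ℕP.+-suc (ℓ w) (length t) ⟨
  ℓ w + length (j ∷ t)             ∎
  where open ℕP.≤-Reasoning

ℓ-increasing-positive : ∀ {w} → Linked ℤ._<_ w → All Pos w → ℓ w ≡ 0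
ℓ-increasing-positive []             []        = refl
ℓ-increasing-positive {a ∷ w} inc (0<a ∷ pos) =
  cong₂ _+_ (cong₂ _+_ (cong χ (<ᶻᵇ-false (ℤP.<-asym 0<a)))
                       (sum-zero w (All.zipWith no-inversion
                                      (Linked-head ℤP.<-trans inc , pos))))
            (ℓ-increasing-positive (Linked.tail inc) pos)
  where
  no-inversion : ∀ {b} → a ℤ.< b × Pos b → pairInversions a b ≡ 0
  no-inversion (a<b , 0<b) =
    cong₂ _+_ (cong χ (<ᶻᵇ-false (ℤP.<-asym a<b))) (cong χ (<ᶻᵇ-false (positive-¬<-neg 0<a 0<b)))
  sum-zero : ∀ v → All (λ b → pairInversions a b ≡ 0) v → sum (map (pairInversions a) v) ≡ 0
  sum-zero []      []       = refl
  sum-zero (b ∷ v) (e ∷ es) = cong₂ _+_ e (sum-zero v es)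

ℓ-identity : ∀ n → ℓ (identity n) ≡ 0
ℓ-identity n rewrite identity≡rangeℤ n = ℓ-increasing-positive (rangeℤ-increasing 1 n) (rangeℤ-positive 0 n)

ℓ-evalWord-≤ : ∀ n t → ℓ (evalWord n t) ≤ length t
ℓ-evalWord-≤ n t = subst (λ z → ℓ (evalWord n t) ≤ z + length t) (ℓ-identity n) (ℓ-foldl-≤ (identity n) t)

swapAt-++ : ∀ xs k ys → swapAt (k + length xs) (xs ++ ys) ≡ xs ++ swapAt k ys
swapAt-++ []       k ys = cong (λ i → swapAt i ys) (ℕP.+-identityʳ k)
swapAt-++ (x ∷ xs) k ys rewrite ℕP.+-suc k (length xs) = cong (x ∷_) (swapAt-++ xs k ys)

swapDescent-++⁺ : ∀ xs k {ys} → SwapDescent ys k → SwapDescent (xs ++ ys) (k + length xs)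
swapDescent-++⁺ []       k {ys} d = subst (SwapDescent ys) (sym (ℕP.+-identityʳ k)) d
swapDescent-++⁺ (x ∷ xs) k      d rewrite ℕP.+-suc k (length xs) = swapDescent-++⁺ xs k d

ℓ-swapAt-++-descent : ∀ xs k ys → SwapDescent ys k → ℓ (xs ++ ys) ≡ suc (ℓ (xs ++ swapAt k ys))
ℓ-swapAt-++-descent xs k ys d =
  trans (ℓ-swapAt-descent (k + length xs) (xs ++ ys) (swapDescent-++⁺ xs k d))
        (cong (λ v → suc (ℓ v)) (swapAt-++ xs k ys))

increasing⇒¬swapDescent : ∀ {w} k → Linked ℤ._<_ w → ¬ SwapDescent w k
increasing⇒¬swapDescent {a ∷ b ∷ w} zero    (a<b ∷ _) b<a = ℤP.<-asym a<b b<a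
increasing⇒¬swapDescent {a ∷ w}     (suc k) inc       d   = increasing⇒¬swapDescent k (Linked.tail inc) d

evalWord-∷ʳ : ∀ n t j → evalWord n (t ∷ʳ j) ≡ actGen (evalWord n t) j
evalWord-∷ʳ n t j = ListP.foldl-++ actGen (identity n) t (j ∷ [])

length-∷ʳ : ∀ (t : List ℕ) j → length (t ∷ʳ j) ≡ suc (length t)
length-∷ʳ t j = trans (ListP.length-++ t) (ℕP.+-comm (length t) 1)

-- A word of length ℓ w for w; by ℓ-evalWord-≤ it is reduced.
MinimalWord : ℕ → List ℤ → List ℕ → Set
MinimalWord n w t = evalWord n t ≡ w × length t ≡ ℓ w

UniqueMinimalWord : ℕ → List ℤ → Set
UniqueMinimalWord n w = ∀ t t′ → MinimalWord n w t → MinimalWord n w t′ → t ≡ t′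

minimalWord-∷ʳ : ∀ {n w} t j → MinimalWord n w (t ∷ʳ j) → Descent w j × MinimalWord n (actGen w j) t
minimalWord-∷ʳ {n} {w} t j (eval , len) = descent , eval′ , len′
  where
  eval′ : evalWord n t ≡ actGen w j
  eval′ = trans (sym (actGen-involutive (evalWord n t) j))
                (cong (λ v → actGen v j) (trans (sym (evalWord-∷ʳ n t j)) eval))
  ℓ≤ : ℓ (actGen w j) ≤ length t
  ℓ≤ = subst (λ v → ℓ v ≤ length t) eval′ (ℓ-evalWord-≤ n t)
  ℓw : suc (length t) ≡ ℓ w
  ℓw = trans (sym (length-∷ʳ t j)) len
  descent : Descent w j
  descent = ℓ-actGen-<⇒descent w j (ℕP.≤-<-trans ℓ≤ (ℕP.≤-reflexive ℓw))
  len′ : length t ≡ ℓ (actGen w j)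
  len′ = ℕP.≤-antisym (ℕP.≤-pred (ℕP.≤-trans (ℕP.≤-reflexive ℓw) (ℓ-≤-actGen w j))) ℓ≤

descent⇒ℓ≢0 : ∀ w j → Descent w j → ℓ w ≢ 0
descent⇒ℓ≢0 w j d ℓ≡0 = ℕP.0≢1+n (trans (sym ℓ≡0) (ℓ-actGen-descent w j d))

noDescent⇒uniqueMinimalWord : ∀ {n w} → (∀ j → ¬ Descent w j) → UniqueMinimalWord n w
noDescent⇒uniqueMinimalWord {n} {w} noDescent t t′ m m′ = trans (empty t m) (sym (empty t′ m′))
  where
  empty : ∀ t → MinimalWord n w t → t ≡ []
  empty t m with initLast t
  ... | []        = refl
  ... | t₁ ∷ʳ′ j  = ⊥-elim (noDescent j (proj₁ (minimalWord-∷ʳ t₁ j m)))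

-- If s_j is the only right descent of w, every reduced word of w ends with s_j.
uniqueDescent⇒uniqueMinimalWord : ∀ {n w} j → (∀ i → Descent w i → i ≡ j) →
  UniqueMinimalWord n (actGen w j) → UniqueMinimalWord n w
uniqueDescent⇒uniqueMinimalWord {n} {w} j only u t t′ m m′ with initLast t | initLast t′
... | []       | []         = refl
... | []       | t₁ ∷ʳ′ i   = ⊥-elim (descent⇒ℓ≢0 w i (proj₁ (minimalWord-∷ʳ t₁ i m′)) (sym (proj₂ m)))
... | t₁ ∷ʳ′ i | []         = ⊥-elim (descent⇒ℓ≢0 w i (proj₁ (minimalWord-∷ʳ t₁ i m)) (sym (proj₂ m′)))
... | t₁ ∷ʳ′ i | t₁′ ∷ʳ′ i′ with minimalWord-∷ʳ t₁ i m | minimalWord-∷ʳ t₁′ i′ m′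
... | d , m₁ | d′ , m₁′ with only i d | only i′ d′
... | refl | refl = cong (_∷ʳ j) (u t₁ t₁′ m₁ m₁′)

reduced⇒minimal : ∀ {n w t₀ s} → IsWord n t₀ → MinimalWord n w t₀ → IsReduced n w s → MinimalWord n w s
reduced⇒minimal {n} {w} {t₀} {s} word₀ (eval₀ , len₀) (_ , eval , shortest) =
  eval , ℕP.≤-antisym (ℕP.≤-trans (shortest t₀ word₀ eval₀) (ℕP.≤-reflexive len₀))
                      (subst (λ v → ℓ v ≤ length s) eval (ℓ-evalWord-≤ n s))

minimal-++⇒reduced : ∀ {n u w t tail} → IsWord n t → MinimalWord n u t → IsWord n tail →
  foldl actGen u tail ≡ w → ℓ u + length tail ≡ ℓ w → IsReduced n w (t ++ tail)
minimal-++⇒reduced {n} {u} {w} {t} {tail} word (eval , len) word′ eval′ ℓ≡ =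
  AllP.++⁺ word word′ , evalWord-++ , λ t′ _ eval-t′ → begin
    length (t ++ tail)       ≡⟨ ListP.length-++ t ⟩
    length t + length tail   ≡⟨ cong (_+ length tail) len ⟩
    ℓ u + length tail        ≡⟨ ℓ≡ ⟩
    ℓ w                      ≡⟨ cong ℓ eval-t′ ⟨
    ℓ (evalWord n t′)        ≤⟨ ℓ-evalWord-≤ n t′ ⟩
    length t′                ∎
  where
  open ℕP.≤-Reasoning
  evalWord-++ : evalWord n (t ++ tail) ≡ w
  evalWord-++ = trans (ListP.foldl-++ actGen (identity n) t tail)
                      (trans (cong (λ v → foldl actGen v tail) eval) eval′)

minimalWord-singleton : ∀ {n w} j i → evalWord n (j ∷ []) ≡ w → Descent w i → MinimalWord n w (j ∷ [])
minimalWord-singleton {n} {w} j i eval d = eval , ℕP.≤-antisym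
  (subst (1 ≤_) (sym (ℓ-actGen-descent w i d)) (s≤s z≤n))
  (subst (λ v → ℓ v ≤ 1) eval (ℓ-evalWord-≤ n (j ∷ [])))

ReducedWordsCommute : ℕ → List ℤ → Set
ReducedWordsCommute n w = ∀ s t → IsReduced n w s → IsReduced n w t → Star CommStep s t

uniqueMinimalWord⇒commute : ∀ {n w t₀} → IsWord n t₀ → MinimalWord n w t₀ → UniqueMinimalWord n w →
  ReducedWordsCommute n w
uniqueMinimalWord⇒commute word₀ m₀ u s t rs rt
  with u s t (reduced⇒minimal word₀ m₀ rs) (reduced⇒minimal word₀ m₀ rt)
... | refl = ε

signedPerm-resp-↭ : ∀ {n xs ys} → xs ↭ ys → IsSignedPerm n xs → IsSignedPerm n ys
signedPerm-resp-↭ xs↭ys (len , bounds , distinct) =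
  trans (sym (↭P.↭-length xs↭ys)) len , ↭P.All-resp-↭ xs↭ys bounds ,
  ↭ₛP.Unique-resp-↭ (setoid ℕ) (↭⇒↭ₛ (↭P.map⁺ ∣_∣ xs↭ys)) distinct

swapAt-↭ : ∀ k w → swapAt k w ↭ w
swapAt-↭ zero    []          = ↭.refl
swapAt-↭ zero    (a ∷ [])    = ↭.refl
swapAt-↭ zero    (a ∷ b ∷ w) = ↭.swap b a ↭.refl
swapAt-↭ (suc k) []          = ↭.refl
swapAt-↭ (suc k) (a ∷ w)     = ↭.prep a (swapAt-↭ k w)

actGen-preserves-SignedPerm : ∀ n w j → IsSignedPerm n w → IsSignedPerm n (actGen w j)
actGen-preserves-SignedPerm n []      zero    sp                   = sp
actGen-preserves-SignedPerm n (a ∷ w) zero    (len , (r ∷ rs) , u) =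
  len , subst (λ z → 1 ≤ z × z ≤ n) (sym (ℤP.∣-i∣≡∣i∣ a)) r ∷ rs ,
  subst (λ z → Unique (z ∷ map ∣_∣ w)) (sym (ℤP.∣-i∣≡∣i∣ a)) u
actGen-preserves-SignedPerm n w       (suc k) sp                   = signedPerm-resp-↭ (↭.↭-sym (swapAt-↭ k w)) sp

identity-signedPerm : ∀ n → IsSignedPerm n (identity n)
identity-signedPerm n rewrite identity≡rangeℤ n =
  length-rangeℤ 1 n , bounds 1 n (s≤s z≤n) ℕP.≤-refl ,
  subst Unique (sym (map-abs-rangeℤ 1 n))
    (AllPairs.map (λ x<y x≡y → ℕP.<-irrefl x≡y x<y) (LinkedP.Linked⇒AllPairs ℕP.<-trans (range-increasing 1 n)))
  where
  bounds : ∀ a L → 1 ≤ a → a + L ≤ suc n → All (λ b → 1 ≤ ∣ b ∣ × ∣ b ∣ ≤ n) (rangeℤ a L)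
  bounds a zero    _   _   = []
  bounds a (suc L) 1≤a a+L≤ =
    (1≤a , ℕP.≤-pred (ℕP.≤-trans (ℕP.≤-reflexive (ℕP.+-comm 1 a)) (ℕP.≤-trans (ℕP.+-monoʳ-≤ a (s≤s z≤n)) a+L≤))) ∷
    bounds (suc a) L (s≤s z≤n) (ℕP.≤-trans (ℕP.≤-reflexive (sym (ℕP.+-suc a L))) a+L≤)

HeadNonNegative : List ℤ → Set
HeadNonNegative []      = ⊤
HeadNonNegative (a ∷ _) = + 0 ℤ.≤ a

swapDescent? : ∀ w → ∃ (SwapDescent w) ⊎ Linked ℤ._≤_ w
swapDescent? []          = inj₂ []
swapDescent? (a ∷ [])    = inj₂ [-]
swapDescent? (a ∷ b ∷ w) with b ℤ.<? a | swapDescent? (b ∷ w)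
... | yes b<a | _              = inj₁ (0 , b<a)
... | no _    | inj₁ (k , d)   = inj₁ (suc k , d)
... | no b≮a  | inj₂ ascending = inj₂ (ℤP.≮⇒≥ b≮a ∷ ascending)

descent? : ∀ w → ∃ (Descent w) ⊎ (Linked ℤ._≤_ w × HeadNonNegative w)
descent? []      = inj₂ ([] , tt)
descent? (a ∷ w) with a ℤ.<? + 0 | swapDescent? (a ∷ w)
... | yes a<0 | _              = inj₁ (0 , a<0)
... | no _    | inj₁ (k , d)   = inj₁ (suc k , d)
... | no a≮0  | inj₂ ascending = inj₂ (ascending , ℤP.≮⇒≥ a≮0)

swapDescent<length : ∀ w k → SwapDescent w k → suc k < length w
swapDescent<length (a ∷ b ∷ w) zero    _ = s≤s (s≤s z≤n)
swapDescent<length (a ∷ w)     (suc k) d = s≤s (swapDescent<length w k d)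

descent<length : ∀ w j → Descent w j → j < length w
descent<length (a ∷ w) zero    _ = s≤s z≤n
descent<length w       (suc k) d = swapDescent<length w k d

noDescent⇒identity : ∀ n w → IsSignedPerm n w → Linked ℤ._≤_ w → HeadNonNegative w → w ≡ identity n
noDescent⇒identity n []      (len , _ , _)  _ _ = subst (λ m → [] ≡ identity m) len refl
noDescent⇒identity n (a ∷ w) (len , bounds , distinct) ascending 0≤a = begin
  a ∷ w                             ≡⟨ map-abs-positive pos ⟨
  map (λ k → + k) (map ∣_∣ (a ∷ w)) ≡⟨ cong (map (λ k → + k)) abs≡range ⟩
  rangeℤ 1 n                        ≡⟨ identity≡rangeℤ n ⟨
  identity n                        ∎
  where
  open ≡-Reasoning
  0<a : Pos a
  0<a = nonNegative⇒positive 0≤a (proj₁ (All.head bounds))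
  pos : All Pos (a ∷ w)
  pos = 0<a ∷ All.map (ℤP.<-≤-trans 0<a) (Linked-head ℤP.≤-trans ascending)
  abs≡range : map ∣_∣ (a ∷ w) ≡ range 1 n
  abs≡range = increasing-bounded⇒range (map ∣_∣ (a ∷ w)) n 1 (trans (ListP.length-map ∣_∣ (a ∷ w)) len)
    (AllP.map⁺ (All.map proj₁ bounds)) (AllP.map⁺ (All.map (λ b → s≤s (proj₂ b)) bounds))
    (map-abs-increasing pos (≤-distinct⇒< ascending distinct))

-- Sorting by descents: each descent step lowers ℓ by one, and a descent-free signed permutation is the identity.
minimalWord-exists : ∀ n w → IsSignedPerm n w → ∃ λ t → IsWord n t × MinimalWord n w t
minimalWord-exists n w sp = go (ℓ w) w refl sp
  where
  go : ∀ s w → ℓ w ≡ s → IsSignedPerm n w → ∃ λ t → IsWord n t × MinimalWord n w t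
  go s w ℓw sp with descent? w
  go s w ℓw sp | inj₂ (ascending , head) with noDescent⇒identity n w sp ascending head
  ... | refl = [] , [] , refl , sym (ℓ-identity n)
  go zero    w ℓw sp | inj₁ (j , d) = ⊥-elim (descent⇒ℓ≢0 w j d ℓw)
  go (suc s) w ℓw sp | inj₁ (j , d)
    with go s (actGen w j) ℓ′ (actGen-preserves-SignedPerm n w j sp)
    where ℓ′ = ℕP.suc-injective (trans (sym (ℓ-actGen-descent w j d)) ℓw)
  ... | t , word , eval , len =
    t ∷ʳ j ,
    AllP.∷ʳ⁺ word (subst (j <_) (proj₁ sp) (descent<length w j d)) ,
    trans (evalWord-∷ʳ n t j) (trans (cong (λ v → actGen v j) eval) (actGen-involutive w j)) ,
    trans (length-∷ʳ t j) (trans (cong suc len) (sym (ℓ-actGen-descent w j d)))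

-- Signed permutations with a unique reduced word

insertion-swapDescent : ∀ L x R i → Linked ℤ._<_ (L ++ R) → All (ℤ._< x) L → SwapDescent (L ++ x ∷ R) i →
  i ≡ length L × ∃ λ r → ∃ λ R′ → R ≡ r ∷ R′ × r ℤ.< x
insertion-swapDescent []           x (r ∷ R) zero    inc _             d = refl , r , R , refl , d
insertion-swapDescent []           x R       (suc i) inc _             d = ⊥-elim (increasing⇒¬swapDescent i inc d)
insertion-swapDescent (y ∷ [])     x R       zero    _   (y<x ∷ _)     d = ⊥-elim (ℤP.<-asym d y<x)
insertion-swapDescent (y ∷ y′ ∷ L) x R       zero    (y<y′ ∷ _) _      d = ⊥-elim (ℤP.<-asym d y<y′)
insertion-swapDescent (y ∷ L)      x R       (suc i) inc (_ ∷ <x)      d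
  with insertion-swapDescent L x R i (Linked.tail inc) <x d
... | i≡ , rest = cong suc i≡ , rest

insertion-descent : ∀ L x R j → Linked ℤ._<_ (L ++ R) → All (ℤ._< x) L → All Pos (L ++ x ∷ R) →
  Descent (L ++ x ∷ R) j → j ≡ suc (length L) × ∃ λ r → ∃ λ R′ → R ≡ r ∷ R′ × r ℤ.< x
insertion-descent []      x R zero    _   _  (0<x ∷ _) x<0 = ⊥-elim (ℤP.<-asym 0<x x<0)
insertion-descent (y ∷ L) x R zero    _   _  (0<y ∷ _) y<0 = ⊥-elim (ℤP.<-asym 0<y y<0)
insertion-descent L       x R (suc i) inc <x _         d
  with insertion-swapDescent L x R i inc <x d
... | i≡ , rest = cong suc i≡ , rest

-- Bubbling x to the right through the smaller entries of R is forced step by step.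
insertion-uniqueMinimalWord : ∀ n R L x → Linked ℤ._<_ (L ++ R) → All (ℤ._< x) L → All Pos (L ++ x ∷ R) →
  UniqueMinimalWord n (L ++ x ∷ R)
insertion-uniqueMinimalWord n [] L x inc <x pos = noDescent⇒uniqueMinimalWord noDescent
  where
  noDescent : ∀ j → ¬ Descent (L ++ x ∷ []) j
  noDescent j d with insertion-descent L x [] j inc <x pos d
  ... | _ , _ , _ , () , _
insertion-uniqueMinimalWord n (r ∷ R) L x inc <x pos with r ℤ.<? x
... | no r≮x = noDescent⇒uniqueMinimalWord noDescent
  where
  noDescent : ∀ j → ¬ Descent (L ++ x ∷ r ∷ R) j
  noDescent j d with insertion-descent L x (r ∷ R) j inc <x pos d
  ... | _ , _ , _ , refl , r<x = r≮x r<x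
... | yes r<x = uniqueDescent⇒uniqueMinimalWord (suc (length L))
  (λ j d → proj₁ (insertion-descent L x (r ∷ R) j inc <x pos d))
  (subst (UniqueMinimalWord n) moved
    (insertion-uniqueMinimalWord n R (L ++ r ∷ []) x
      (subst (Linked ℤ._<_) (sym (ListP.++-assoc L (r ∷ []) R)) inc)
      (AllP.++⁺ <x (r<x ∷ []))
      (subst (All Pos) (sym (ListP.++-assoc L (r ∷ []) (x ∷ R))) pos′)))
  where
  moved : (L ++ r ∷ []) ++ x ∷ R ≡ swapAt (length L) (L ++ x ∷ r ∷ R)
  moved = trans (ListP.++-assoc L (r ∷ []) (x ∷ R)) (sym (swapAt-++ L 0 (x ∷ r ∷ R)))
  pos′ : All Pos (L ++ r ∷ x ∷ R)
  pos′ with AllP.++⁻ L pos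
  ... | posL , 0<x ∷ 0<r ∷ posR = AllP.++⁺ posL (0<r ∷ 0<x ∷ posR)

negativeHead-onlyDescent : ∀ a Q → a ℤ.< + 0 → Linked ℤ._<_ Q → All Pos Q → ∀ j → Descent (a ∷ Q) j → j ≡ 0
negativeHead-onlyDescent a Q       a<0 inc pos         zero          _   = refl
negativeHead-onlyDescent a (q ∷ Q) a<0 inc (0<q ∷ _)   (suc zero)    q<a = ⊥-elim (ℤP.<-asym q<a (ℤP.<-trans a<0 0<q))
negativeHead-onlyDescent a Q       a<0 inc pos         (suc (suc k)) d   = ⊥-elim (increasing⇒¬swapDescent k inc d)

negativeHead-uniqueMinimalWord : ∀ n a Q → a ℤ.< + 0 → Linked ℤ._<_ Q → All Pos Q →
  UniqueMinimalWord n (a ∷ Q)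
negativeHead-uniqueMinimalWord n a Q a<0 inc pos =
  uniqueDescent⇒uniqueMinimalWord 0 (negativeHead-onlyDescent a Q a<0 inc pos)
    (insertion-uniqueMinimalWord n Q [] (- a) inc [] (neg-negative a<0 ∷ pos))

negativeHead-FC : ∀ n r Q → IsSignedPerm n (r ∷ Q) → r ℤ.< + 0 → Linked ℤ._<_ Q → All Pos Q → IsFC n (r ∷ Q)
negativeHead-FC n r Q sp r<0 inc pos with minimalWord-exists n (r ∷ Q) sp
... | t , word , minimal =
  sp , uniqueMinimalWord⇒commute word minimal (negativeHead-uniqueMinimalWord n r Q r<0 inc pos)

-- Commutation classes

Adjacent : ℕ → ℕ → Set
Adjacent i x = x ≡ i ⊎ x ≡ suc i

adjacent? : ∀ i x → Dec (Adjacent i x)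
adjacent? i x = (x ℕ.≟ i) ⊎-dec (x ℕ.≟ suc i)

-- The subword of letters i and i+1: commutation moves never swap two such letters.
letters : ℕ → List ℕ → List ℕ
letters i = filter (adjacent? i)

adjacent-close : ∀ {i x y} → Adjacent i x → Adjacent i y → x ≤ suc y
adjacent-close (inj₁ refl) (inj₁ refl) = ℕP.n≤1+n _
adjacent-close (inj₁ refl) (inj₂ refl) = ℕP.≤-trans (ℕP.n≤1+n _) (ℕP.n≤1+n _)
adjacent-close (inj₂ refl) (inj₁ refl) = ℕP.≤-refl
adjacent-close (inj₂ refl) (inj₂ refl) = ℕP.n≤1+n _

far⇒¬bothAdjacent : ∀ i {a b} → (2 + a ≤ b ⊎ 2 + b ≤ a) → ¬ (Adjacent i a × Adjacent i b)
far⇒¬bothAdjacent i (inj₁ a+2≤b) (adj-a , adj-b) = ℕP.<-irrefl refl (ℕP.≤-trans a+2≤b (adjacent-close adj-b adj-a))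
far⇒¬bothAdjacent i (inj₂ b+2≤a) (adj-a , adj-b) = ℕP.<-irrefl refl (ℕP.≤-trans b+2≤a (adjacent-close adj-a adj-b))

letters-commStep : ∀ i {s t} → CommStep s t → letters i s ≡ letters i t
letters-commStep i (comm u v a b far) = begin
  letters i (u ++ a ∷ b ∷ v)            ≡⟨ ListP.filter-++ (adjacent? i) u (a ∷ b ∷ v) ⟩
  letters i u ++ letters i (a ∷ b ∷ v)  ≡⟨ cong (letters i u ++_)
                                             (filter-swap (adjacent? i) v (far⇒¬bothAdjacent i far)) ⟩
  letters i u ++ letters i (b ∷ a ∷ v)  ≡⟨ ListP.filter-++ (adjacent? i) u (b ∷ a ∷ v) ⟨
  letters i (u ++ b ∷ a ∷ v)            ∎
  where open ≡-Reasoning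

letters-commStar : ∀ i {s t} → Star CommStep s t → letters i s ≡ letters i t
letters-commStar i ε          = refl
letters-commStar i (st ◅ sts) = trans (letters-commStep i st) (letters-commStar i sts)

braid-¬commStar : ∀ i r → ¬ Star CommStep (r ++ i ∷ suc i ∷ i ∷ []) (r ++ suc i ∷ i ∷ suc i ∷ [])
braid-¬commStar i r st = ℕP.1+n≢n (sym (proj₁ (ListP.∷-injective (begin
  i ∷ letters i (suc i ∷ i ∷ [])          ≡⟨ ListP.filter-accept (adjacent? i) (inj₁ refl) ⟨
  letters i (i ∷ suc i ∷ i ∷ [])           ≡⟨ ListP.++-cancelˡ (letters i r) _ _ lettersEq ⟩
  letters i (suc i ∷ i ∷ suc i ∷ [])       ≡⟨ ListP.filter-accept (adjacent? i) (inj₂ refl) ⟩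
  suc i ∷ letters i (i ∷ suc i ∷ [])      ∎))))
  where
  open ≡-Reasoning
  lettersEq : letters i r ++ letters i (i ∷ suc i ∷ i ∷ []) ≡ letters i r ++ letters i (suc i ∷ i ∷ suc i ∷ [])
  lettersEq = trans (sym (ListP.filter-++ (adjacent? i) r _))
                    (trans (letters-commStar i st) (ListP.filter-++ (adjacent? i) r _))

-- p > q > r in consecutive positions give the reduced words r₀ sᵢ sᵢ₊₁ sᵢ and r₀ sᵢ₊₁ sᵢ sᵢ₊₁,
-- where r₀ is a reduced word of the permutation with p, q, r sorted.
decreasingTriple⇒¬commute : ∀ n P p q r S → IsSignedPerm n (P ++ p ∷ q ∷ r ∷ S) →
  q ℤ.< p → r ℤ.< q → ¬ ReducedWordsCommute n (P ++ p ∷ q ∷ r ∷ S)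
decreasingTriple⇒¬commute n P p q r S sp q<p r<q commute =
  braid-¬commStar i r₀ (commute (r₀ ++ i ∷ suc i ∷ i ∷ []) (r₀ ++ suc i ∷ i ∷ suc i ∷ [])
    (minimal-++⇒reduced word₀ minimal₀ (i<n ∷ si<n ∷ i<n ∷ []) eval₁ ℓw)
    (minimal-++⇒reduced word₀ minimal₀ (si<n ∷ i<n ∷ si<n ∷ []) eval₂ ℓw))
  where
  open ≡-Reasoning
  i = suc (length P)
  w = P ++ p ∷ q ∷ r ∷ S
  u = P ++ r ∷ q ∷ p ∷ S
  ℓw : ℓ u + 3 ≡ ℓ w
  ℓw = sym (begin
    ℓ w                                ≡⟨ ℓ-swapAt-++-descent P 0 (p ∷ q ∷ r ∷ S) q<p ⟩
    suc (ℓ (P ++ q ∷ p ∷ r ∷ S))       ≡⟨ cong suc (ℓ-swapAt-++-descent P 1 (q ∷ p ∷ r ∷ S) (ℤP.<-trans r<q q<p)) ⟩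
    suc (suc (ℓ (P ++ q ∷ r ∷ p ∷ S))) ≡⟨ cong (λ k → suc (suc k)) (ℓ-swapAt-++-descent P 0 (q ∷ r ∷ p ∷ S) r<q) ⟩
    3 + ℓ u                            ≡⟨ ℕP.+-comm 3 (ℓ u) ⟩
    ℓ u + 3                            ∎)
  i<n : i < n
  i<n = subst (i <_) (proj₁ sp) (swapDescent<length w (length P) (swapDescent-++⁺ P 0 q<p))
  si<n : suc i < n
  si<n = subst (suc i <_) (proj₁ sp) (swapDescent<length w (suc (length P)) (swapDescent-++⁺ P 1 r<q))
  sorted : actGen (actGen (actGen w i) (suc i)) i ≡ u
  sorted = trans (cong (λ v → actGen (actGen v (suc i)) i) (swapAt-++ P 0 _))
                 (trans (cong (λ v → actGen v i) (swapAt-++ P 1 _)) (swapAt-++ P 0 _))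
  minimal-u = minimalWord-exists n u (subst (IsSignedPerm n) sorted
    (actGen-preserves-SignedPerm n _ i (actGen-preserves-SignedPerm n _ (suc i) (actGen-preserves-SignedPerm n w i sp))))
  r₀ = proj₁ minimal-u
  word₀ = proj₁ (proj₂ minimal-u)
  minimal₀ = proj₂ (proj₂ minimal-u)
  eval₁ : foldl actGen u (i ∷ suc i ∷ i ∷ []) ≡ w
  eval₁ = begin
    actGen (actGen (actGen u i) (suc i)) i         ≡⟨ cong (λ v → actGen (actGen v (suc i)) i) (swapAt-++ P 0 _) ⟩
    actGen (actGen (P ++ q ∷ r ∷ p ∷ S) (suc i)) i ≡⟨ cong (λ v → actGen v i) (swapAt-++ P 1 _) ⟩
    actGen (P ++ q ∷ p ∷ r ∷ S) i                  ≡⟨ swapAt-++ P 0 _ ⟩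
    w                                              ∎
  eval₂ : foldl actGen u (suc i ∷ i ∷ suc i ∷ []) ≡ w
  eval₂ = begin
    actGen (actGen (actGen u (suc i)) i) (suc i)   ≡⟨ cong (λ v → actGen (actGen v i) (suc i)) (swapAt-++ P 1 _) ⟩
    actGen (actGen (P ++ r ∷ p ∷ q ∷ S) i) (suc i) ≡⟨ cong (λ v → actGen v (suc i)) (swapAt-++ P 0 _) ⟩
    actGen (P ++ p ∷ r ∷ q ∷ S) (suc i)            ≡⟨ swapAt-++ P 1 _ ⟩
    w                                              ∎

-- In w = P q r with q > 0 > r, full commutativity forbids p > q > r for the last entry p of P.
prefix-increasing : ∀ n P q r → IsFC n (P ++ q ∷ r ∷ []) → All Pos P → Linked ℤ._<_ P → + 0 ℤ.< q → r ℤ.< + 0 →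
  Linked ℤ._<_ (P ∷ʳ q)
prefix-increasing n P q r (sp , commute) pos inc 0<q r<0 with initLast P
... | []        = [-]
... | P′ ∷ʳ′ p with q ℤ.<? p
...   | yes q<p = ⊥-elim (decreasingTriple⇒¬commute n P′ p q r []
                    (subst (IsSignedPerm n) reassoc sp) q<p (ℤP.<-trans r<0 0<q)
                    (subst (ReducedWordsCommute n) reassoc commute))
  where reassoc = ListP.++-assoc P′ (p ∷ []) (q ∷ r ∷ [])
...   | no q≮p  = Linked-∷ʳ⁺ P′ inc (ℤP.≤∧≢⇒< (ℤP.≮⇒≥ q≮p) p≢q)
  where
  p≢q : p ≢ q
  p≢q p≡q with AllPairs-++⁻ʳ (map ∣_∣ P′)
                 (subst Unique (trans (cong (map ∣_∣) (ListP.++-assoc P′ (p ∷ []) (q ∷ r ∷ [])))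
                                      (ListP.map-++ ∣_∣ P′ (p ∷ q ∷ r ∷ []))) (proj₂ (proj₂ sp)))
  ... | (∣p∣≢∣q∣ ∷ _) ∷ _ = ∣p∣≢∣q∣ (cong ∣_∣ p≡q)

-- The element e = [-1, 2, …, m+1, m+3, m+2] of B_{m+3}: its reduced words are s₀ s_{m+2} and s_{m+2} s₀.
module Witness (m : ℕ) where

  n : ℕ
  n = 3 + m

  low high : ℤ
  low  = + (2 + m)
  high = + (3 + m)

  X : List ℤ
  X = rangeℤ 2 m ++ high ∷ low ∷ []

  e c d : List ℤ
  e = -[1+ 0 ] ∷ X
  c = + 1 ∷ X
  d = -[1+ 0 ] ∷ rangeℤ 2 (2 + m)

  rangeℤ-split : rangeℤ 2 (2 + m) ≡ rangeℤ 2 m ++ low ∷ high ∷ []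
  rangeℤ-split = trans (rangeℤ-∷ʳ 2 (suc m))
    (trans (cong (_∷ʳ high) (rangeℤ-∷ʳ 2 m)) (ListP.++-assoc (rangeℤ 2 m) (low ∷ []) (high ∷ [])))

  swapAt-m : swapAt m (rangeℤ 2 m ++ low ∷ high ∷ []) ≡ X
  swapAt-m = subst (λ k → swapAt k (rangeℤ 2 m ++ low ∷ high ∷ []) ≡ X) (length-rangeℤ 2 m)
                   (swapAt-++ (rangeℤ 2 m) 0 (low ∷ high ∷ []))

  evalWord-d : evalWord n (0 ∷ []) ≡ d
  evalWord-d = cong negHead (identity≡rangeℤ n)

  evalWord-c : evalWord n (2 + m ∷ []) ≡ c
  evalWord-c = trans (cong (swapAt (suc m)) (identity≡rangeℤ n))
                     (cong (+ 1 ∷_) (trans (cong (swapAt m) rangeℤ-split) swapAt-m))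

  evalWord-e : evalWord n (0 ∷ 2 + m ∷ []) ≡ e
  evalWord-e = trans (cong (λ v → actGen v (2 + m)) evalWord-d)
                     (cong (-[1+ 0 ] ∷_) (trans (cong (swapAt m) rangeℤ-split) swapAt-m))

  actGen-e : actGen e (2 + m) ≡ d
  actGen-e = cong (-[1+ 0 ] ∷_) (trans (cong (swapAt m) (sym swapAt-m))
               (trans (swapAt-involutive m _) (sym rangeℤ-split)))

  X-positive : All Pos X
  X-positive = AllP.++⁺ (rangeℤ-positive 1 m) (+<+ (s≤s z≤n) ∷ +<+ (s≤s z≤n) ∷ [])

  rangeℤ-low-increasing : Linked ℤ._<_ (rangeℤ 2 m ++ low ∷ [])
  rangeℤ-low-increasing = subst (Linked ℤ._<_) (rangeℤ-∷ʳ 2 m) (rangeℤ-increasing 2 (suc m))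

  rangeℤ-<-high : All (ℤ._< high) (rangeℤ 2 m)
  rangeℤ-<-high = All.map (λ a<low → ℤP.<-trans a<low (+<+ ℕP.≤-refl)) (rangeℤ-< 2 m)

  descents-e : ∀ j → Descent e j → j ≡ 0 ⊎ j ≡ 2 + m
  descents-e zero          _ = inj₁ refl
  descents-e (suc zero)    d with X | X-positive | d
  ... | b ∷ _ | 0<b ∷ _ | b<-1 = ⊥-elim (ℤP.<-asym b<-1 (ℤP.<-trans -<+ 0<b))
  descents-e (suc (suc k)) d =
    inj₂ (cong (λ i → suc (suc i)) (trans (proj₁ (insertion-swapDescent (rangeℤ 2 m) high (low ∷ []) k
                                                      rangeℤ-low-increasing rangeℤ-<-high d))
                                           (length-rangeℤ 2 m)))

  unique-c : UniqueMinimalWord n c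
  unique-c = insertion-uniqueMinimalWord n (low ∷ []) (+ 1 ∷ rangeℤ 2 m) high
    (subst (Linked ℤ._<_) (cong (+ 1 ∷_) (rangeℤ-∷ʳ 2 m)) (rangeℤ-increasing 1 (2 + m)))
    (+<+ (s≤s (s≤s z≤n)) ∷ rangeℤ-<-high)
    (+<+ (s≤s z≤n) ∷ X-positive)

  unique-d : UniqueMinimalWord n d
  unique-d = negativeHead-uniqueMinimalWord n -[1+ 0 ] (rangeℤ 2 (2 + m)) -<+
    (rangeℤ-increasing 2 (2 + m)) (rangeℤ-positive 1 (2 + m))

  minimal-c : MinimalWord n c (2 + m ∷ [])
  minimal-c = minimalWord-singleton {n} (2 + m) (2 + m) evalWord-c
    (subst (SwapDescent X) (length-rangeℤ 2 m) (swapDescent-++⁺ (rangeℤ 2 m) 0 (+<+ ℕP.≤-refl)))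

  minimal-d : MinimalWord n d (0 ∷ [])
  minimal-d = minimalWord-singleton {n} 0 0 evalWord-d -<+

  minimalWords-e : ∀ t → MinimalWord n e t → t ≡ 2 + m ∷ 0 ∷ [] ⊎ t ≡ 0 ∷ 2 + m ∷ []
  minimalWords-e t minimal with initLast t
  ... | [] = ⊥-elim (descent⇒ℓ≢0 e 0 -<+ (sym (proj₂ minimal)))
  ... | t₁ ∷ʳ′ j with minimalWord-∷ʳ t₁ j minimal
  ... | dj , minimal₁ with descents-e j dj
  ... | inj₁ refl = inj₁ (cong (_∷ʳ 0) (unique-c t₁ (2 + m ∷ []) minimal₁ minimal-c))
  ... | inj₂ refl =
    inj₂ (cong (_∷ʳ (2 + m)) (unique-d t₁ (0 ∷ []) (subst (λ v → MinimalWord n v t₁) actGen-e minimal₁) minimal-d))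

  ℓ-e : ℓ e ≡ 2
  ℓ-e = trans (ℓ-actGen-descent e 0 -<+) (cong suc (sym (proj₂ minimal-c)))

  e-FC : IsFC n e
  e-FC = subst (IsSignedPerm n) evalWord-e
           (actGen-preserves-SignedPerm n (actGen (identity n) 0) (2 + m)
             (actGen-preserves-SignedPerm n (identity n) 0 (identity-signedPerm n)))
       , commute
    where
    minimal-e : MinimalWord n e (0 ∷ 2 + m ∷ [])
    minimal-e = evalWord-e , sym ℓ-e
    word-e : IsWord n (0 ∷ 2 + m ∷ [])
    word-e = s≤s z≤n ∷ ℕP.≤-refl ∷ []
    commute : ReducedWordsCommute n e
    commute s t rs rt with minimalWords-e s (reduced⇒minimal word-e minimal-e rs)
                         | minimalWords-e t (reduced⇒minimal word-e minimal-e rt)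
    ... | inj₁ refl | inj₁ refl = ε
    ... | inj₂ refl | inj₂ refl = ε
    ... | inj₁ refl | inj₂ refl = comm [] [] (2 + m) 0 (inj₂ (s≤s (s≤s z≤n))) ◅ ε
    ... | inj₂ refl | inj₁ refl = comm [] [] 0 (2 + m) (inj₁ (s≤s (s≤s z≤n))) ◅ ε

-- Coefficients of Poirier's function

seqs-unique : ∀ m k → Unique (seqs m k)
seqs-unique m zero    = [] ∷ []
seqs-unique m (suc k) = UniqueP.concat⁺
  (AllP.map⁺ (All.universal (λ i → UniqueP.map⁺ (λ e → proj₂ (ListP.∷-injective e)) (seqs-unique m k)) (upTo m)))
  (AllPairsP.map⁺ (AllPairs.map disjoint (UniqueP.upTo⁺ m)))
  where
  disjoint : ∀ {i j} → i ≢ j → ∀ {v} → ¬ (v ∈ map (i ∷_) (seqs m k) × v ∈ map (j ∷_) (seqs m k))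
  disjoint i≢j (v∈i , v∈j) with ∈P.∈-map⁻ (_ ∷_) v∈i | ∈P.∈-map⁻ (_ ∷_) v∈j
  ... | _ , _ , refl | _ , _ , e = i≢j (proj₁ (ListP.∷-injective e))

∈-seqs⁺ : ∀ m σ → All (_< m) σ → σ ∈ seqs m (length σ)
∈-seqs⁺ m []      []         = here refl
∈-seqs⁺ m (i ∷ σ) (i<m ∷ σ<m) = ∈P.∈-concat⁺′ (∈P.∈-map⁺ (_ ∷_) (∈-seqs⁺ m σ σ<m)) (∈P.∈-map⁺ _ (∈P.∈-upTo⁺ i<m))

∈-seqs⁻ : ∀ m k σ → σ ∈ seqs m k → length σ ≡ k × All (_< m) σ
∈-seqs⁻ m zero    σ (here refl) = refl , []
∈-seqs⁻ m (suc k) σ σ∈ with ∈P.∈-concat⁻′ (map (λ i → map (i ∷_) (seqs m k)) (upTo m)) σ∈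
... | _ , σ∈′ , ∈map with ∈P.∈-map⁻ (λ i → map (i ∷_) (seqs m k)) ∈map
... | i , i∈ , refl with ∈P.∈-map⁻ (i ∷_) σ∈′
... | τ , τ∈ , refl with ∈-seqs⁻ m k τ τ∈
... | len , τ<m = cong suc len , ∈P.∈-upTo⁻ i∈ ∷ τ<m

-- For α, β of length 3, FP w α β counts the sequences in seqs 3 (length w) satisfying this test.
contributes : List ℕ → List ℕ → List ℤ → List ℕ → Bool
contributes α β w σ = admissible w σ ∧
  allB (λ v → (expo false v w σ ≡ᵇ lookupD α v) ∧ (expo true v w σ ≡ᵇ lookupD β v)) (upTo 3)

signMatches : Bool → ℤ → Bool
signMatches neg a = (isNeg a ∧ neg) ∨ (not (isNeg a) ∧ not neg)

expo-++ : ∀ neg v w₁ w₂ σ₁ σ₂ → length w₁ ≡ length σ₁ →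
  expo neg v (w₁ ++ w₂) (σ₁ ++ σ₂) ≡ expo neg v w₁ σ₁ + expo neg v w₂ σ₂
expo-++ neg v []       w₂ []       σ₂ _   = refl
expo-++ neg v (a ∷ w₁) w₂ (i ∷ σ₁) σ₂ len =
  trans (cong (λ z → hit + z) (expo-++ neg v w₁ w₂ σ₁ σ₂ (ℕP.suc-injective len))) (sym (ℕP.+-assoc hit _ _))
  where hit = if signMatches neg a then (if i ≡ᵇ v then 1 else 0) else 0

expo-zeros-suc : ∀ neg v P → expo neg (suc v) P (replicate (length P) 0) ≡ 0
expo-zeros-suc neg v []      = refl
expo-zeros-suc neg v (a ∷ P) with signMatches neg a
... | true  = expo-zeros-suc neg v P
... | false = expo-zeros-suc neg v P

expo-zeros-x : ∀ P → All Pos P → expo false 0 P (replicate (length P) 0) ≡ length P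
expo-zeros-x []      []          = refl
expo-zeros-x (a ∷ P) (0<a ∷ pos) rewrite isNeg-positive 0<a = cong suc (expo-zeros-x P pos)

expo-zeros-y : ∀ P → All Pos P → expo true 0 P (replicate (length P) 0) ≡ 0
expo-zeros-y []      []          = refl
expo-zeros-y (a ∷ P) (0<a ∷ pos) rewrite isNeg-positive 0<a = expo-zeros-y P pos

expo-zeros-y≡0 : ∀ P → expo true 0 P (replicate (length P) 0) ≡ 0 → All (λ a → isNeg a ≡ false) P
expo-zeros-y≡0 []      _ = []
expo-zeros-y≡0 (a ∷ P) e with isNeg a in neg
... | false = neg ∷ expo-zeros-y≡0 P e

expo-x+y : ∀ v w σ → length w ≡ length σ → expo false v w σ + expo true v w σ ≡ multiplicity v σ
expo-x+y v []      []      _   = refl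
expo-x+y v (a ∷ w) (i ∷ σ) len with isNeg a | expo-x+y v w σ (ℕP.suc-injective len)
... | true  | ih = trans (ℕP.+-comm (expo false v w σ) _) (trans (ℕP.+-assoc hit _ _)
                     (cong (λ z → hit + z) (trans (ℕP.+-comm (expo true v w σ) _) ih)))
  where hit = if i ≡ᵇ v then 1 else 0
... | false | ih = trans (ℕP.+-assoc hit _ _) (cong (λ z → hit + z) ih)
  where hit = if i ≡ᵇ v then 1 else 0

ExpoMatch : List ℕ → List ℕ → List ℤ → List ℕ → ℕ → Set
ExpoMatch α β w σ v = expo false v w σ ≡ lookupD α v × expo true v w σ ≡ lookupD β v

contributes-true : ∀ α β w σ → contributes α β w σ ≡ true →
  admissible w σ ≡ true × (∀ v → v < 3 → ExpoMatch α β w σ v)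
contributes-true α β w σ c = proj₁ (∧-true (admissible w σ) c) , match
  where
  test : ℕ → Bool
  test v = (expo false v w σ ≡ᵇ lookupD α v) ∧ (expo true v w σ ≡ᵇ lookupD β v)
  pair : ∀ v → test v ≡ true → ExpoMatch α β w σ v
  pair v e = ≡ᵇ-true (proj₁ (∧-true _ e)) , ≡ᵇ-true (proj₂ (∧-true _ e))
  tests : test 0 ∧ (test 1 ∧ (test 2 ∧ true)) ≡ true
  tests = proj₂ (∧-true (admissible w σ) c)
  match : ∀ v → v < 3 → ExpoMatch α β w σ v
  match 0 _ = pair 0 (proj₁ (∧-true (test 0) tests))
  match 1 _ = pair 1 (proj₁ (∧-true (test 1) (proj₂ (∧-true (test 0) tests))))
  match 2 _ = pair 2 (proj₁ (∧-true (test 2) (proj₂ (∧-true (test 1) (proj₂ (∧-true (test 0) tests))))))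
  match (suc (suc (suc v))) (s≤s (s≤s (s≤s ())))

RIncreasing : List ℤ → Set
RIncreasing = Linked (λ a b → ltR b a ≡ false)

admissible-zeros-one : ∀ xs q → RIncreasing xs → admissible (xs ++ q ∷ []) (replicate (length xs) 0 ++ 1 ∷ []) ≡ true
admissible-zeros-one []          q _   = refl
admissible-zeros-one (a ∷ [])    q _   with ltR q a
... | true  = refl
... | false = refl
admissible-zeros-one (a ∷ b ∷ xs) q (b≮a ∷ inc) rewrite b≮a = admissible-zeros-one (b ∷ xs) q inc

admissible-zeros⇒RIncreasing : ∀ xs ys τ → admissible (xs ++ ys) (replicate (length xs) 0 ++ τ) ≡ true → RIncreasing xs
admissible-zeros⇒RIncreasing []           ys τ _   = []
admissible-zeros⇒RIncreasing (a ∷ [])     ys τ _   = [-]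
admissible-zeros⇒RIncreasing (a ∷ b ∷ xs) ys τ adm =
  proj₁ (weak (ltR b a) adm) ∷ admissible-zeros⇒RIncreasing (b ∷ xs) ys τ (proj₂ (weak (ltR b a) adm))
  where
  weak : ∀ c {rest} → ((if c then 0 <ᵇ 0 else 0 ≤ᵇ 0) ∧ rest) ≡ true → c ≡ false × rest ≡ true
  weak false adm = refl , adm

admissible⇒sorted : ∀ w σ → length w ≡ length σ → admissible w σ ≡ true → Linked _≤_ σ
admissible⇒sorted []          []          _   _   = []
admissible⇒sorted (a ∷ [])    (i ∷ [])    _   _   = [-]
admissible⇒sorted (a ∷ b ∷ w) (i ∷ j ∷ σ) len adm =
  step (ltR b a) (proj₁ (∧-true _ adm)) ∷
  admissible⇒sorted (b ∷ w) (j ∷ σ) (ℕP.suc-injective len) (proj₂ (∧-true _ adm))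
  where
  step : ∀ c → (if c then i <ᵇ j else i ≤ᵇ j) ≡ true → i ≤ j
  step true  i<j = ℕP.<⇒≤ (ℕP.<ᵇ⇒< i j (subst T (sym i<j) _))
  step false i≤j = ℕP.≤ᵇ⇒≤ i j (subst T (sym i≤j) _)

RIncreasing-positive⇒increasing : ∀ {P} → RIncreasing P → All Pos P → Unique (map ∣_∣ P) → Linked ℤ._<_ P
RIncreasing-positive⇒increasing {[]}              _           _               _                 = []
RIncreasing-positive⇒increasing {a ∷ []}          _           _               _                 = [-]
RIncreasing-positive⇒increasing {+ x ∷ + y ∷ P} (y≮x ∷ inc) (_ ∷ 0<y ∷ pos) ((x≢y ∷ _) ∷ u) =
  +<+ (ℕP.≤∧≢⇒< (ℕP.≮⇒≥ (λ y<x → subst T y≮x (ℕP.<⇒<ᵇ y<x))) x≢y) ∷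
  RIncreasing-positive⇒increasing inc (0<y ∷ pos) u

increasing-positive⇒RIncreasing : ∀ {Q} → Linked ℤ._<_ Q → All Pos Q → RIncreasing Q
increasing-positive⇒RIncreasing {[]}            _                 _               = []
increasing-positive⇒RIncreasing {a ∷ []}        _                 _               = [-]
increasing-positive⇒RIncreasing {+ x ∷ + y ∷ Q} (+<+ x<y ∷ inc) (_ ∷ 0<y ∷ pos) =
  y≮ᵇx ∷ increasing-positive⇒RIncreasing inc (0<y ∷ pos)
  where
  y≮ᵇx : (y <ᵇ x) ≡ false
  y≮ᵇx with y <ᵇ x in y<ᵇx
  ... | true  = ⊥-elim (ℕP.<-asym x<y (ℕP.<ᵇ⇒< y x (subst T (sym y<ᵇx) _)))
  ... | false = refl

RIncreasing-negativeHead : ∀ {a Q} → a ℤ.< + 0 → RIncreasing Q → All Pos Q → RIncreasing (a ∷ Q)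
RIncreasing-negativeHead {+ n}      {_}              (+<+ ())
RIncreasing-negativeHead { -[1+ k ]} {[]}             _ _   _        = [-]
RIncreasing-negativeHead { -[1+ k ]} {+ y ∷ Q}        _ inc _        = refl ∷ inc
RIncreasing-negativeHead { -[1+ k ]} { -[1+ y ] ∷ Q} _ _   (() ∷ _)

shapeB-increasing : ∀ n P q r → IsFC n (P ++ q ∷ r ∷ []) → All (λ a → isNeg a ≡ false) P → RIncreasing P →
  isNeg q ≡ false → r ℤ.< + 0 → All Pos P × Pos q × Linked ℤ._<_ (P ∷ʳ q)
shapeB-increasing n P q r fc P-nonNeg P-rinc q-nonNeg r<0 =
  P-pos , 0<q , prefix-increasing n P q r fc P-pos P-inc 0<q r<0
  where
  sp = proj₁ fc
  bounds = AllP.++⁻ P (proj₁ (proj₂ sp))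
  P-pos : All Pos P
  P-pos = All.zipWith (λ (nn , b) → ¬isNeg⇒positive nn (proj₁ b)) (P-nonNeg , proj₁ bounds)
  0<q : Pos q
  0<q = ¬isNeg⇒positive q-nonNeg (proj₁ (All.head (proj₂ bounds)))
  P-inc : Linked ℤ._<_ P
  P-inc = RIncreasing-positive⇒increasing P-rinc P-pos
            (AllPairs-++⁻ˡ (map ∣_∣ P) (subst Unique (ListP.map-++ ∣_∣ P _) (proj₂ (proj₂ sp))))

last-two : ∀ k (w : List ℤ) → length w ≡ k + 2 → ∃ λ P → ∃ λ q → ∃ λ r → w ≡ P ++ q ∷ r ∷ [] × length P ≡ k
last-two zero    (q ∷ r ∷ []) _   = [] , q , r , refl , refl
last-two (suc k) (a ∷ w)      len with last-two k w (ℕP.suc-injective len)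
... | P , q , r , refl , lenP = a ∷ P , q , r , refl , cong suc lenP

module Exponents (m : ℕ) where

  α βA βB : List ℕ
  α  = suc m ∷ 1 ∷ 0 ∷ []
  βA = 1 ∷ 0 ∷ 0 ∷ []
  βB = 0 ∷ 0 ∷ 1 ∷ []

  βA↭βB : βA ↭ βB
  βA↭βB = ↭.trans (↭.swap 1 0 ↭.refl) (↭.prep 0 (↭.swap 1 0 ↭.refl))

  σA σB : List ℕ
  σA = replicate (2 + m) 0 ++ 1 ∷ []
  σB = replicate (suc m) 0 ++ 1 ∷ 2 ∷ []

  σA-contributes : ∀ a Q q → a ℤ.< + 0 → All Pos Q → length Q ≡ suc m → Pos q → RIncreasing (a ∷ Q) →
    contributes α βA (a ∷ Q ++ q ∷ []) σA ≡ true
  σA-contributes (+ k)    Q q (+<+ ()) _ _ _ _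
  σA-contributes -[1+ k ] Q q _ pos len 0<q inc =
    cong₂ _∧_ adm (cong₂ _∧_ (cong₂ _∧_ (≡⇒≡ᵇ-true x₁) (≡⇒≡ᵇ-true y₁))
                  (cong₂ _∧_ (cong₂ _∧_ (≡⇒≡ᵇ-true x₂) (≡⇒≡ᵇ-true y₂))
                  (cong₂ _∧_ (cong₂ _∧_ (≡⇒≡ᵇ-true x₃) (≡⇒≡ᵇ-true y₃)) refl)))
    where
    xs = -[1+ k ] ∷ Q
    zeros = replicate (length xs) 0
    σA≡ : σA ≡ zeros ++ 1 ∷ []
    σA≡ = cong (λ z → replicate z 0 ++ 1 ∷ []) (sym (cong suc len))
    split : ∀ neg v → expo neg v (xs ++ q ∷ []) σA ≡ expo neg v xs zeros + expo neg v (q ∷ []) (1 ∷ [])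
    split neg v = trans (cong (expo neg v (xs ++ q ∷ [])) σA≡)
                        (expo-++ neg v xs (q ∷ []) zeros (1 ∷ []) (sym (ListP.length-replicate (length xs))))
    q⁺ = isNeg-positive 0<q
    x₁ : expo false 0 (xs ++ q ∷ []) σA ≡ suc m
    x₁ rewrite split false 0 | q⁺ = trans (ℕP.+-identityʳ _) (trans (expo-zeros-x Q pos) len)
    y₁ : expo true 0 (xs ++ q ∷ []) σA ≡ 1
    y₁ rewrite split true 0 | q⁺ = cong suc (trans (ℕP.+-identityʳ _) (expo-zeros-y Q pos))
    x₂ : expo false 1 (xs ++ q ∷ []) σA ≡ 1
    x₂ rewrite split false 1 | q⁺ | expo-zeros-suc false 0 xs = refl
    y₂ : expo true 1 (xs ++ q ∷ []) σA ≡ 0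
    y₂ rewrite split true 1 | q⁺ | expo-zeros-suc true 0 xs = refl
    x₃ : expo false 2 (xs ++ q ∷ []) σA ≡ 0
    x₃ rewrite split false 2 | q⁺ | expo-zeros-suc false 1 xs = refl
    y₃ : expo true 2 (xs ++ q ∷ []) σA ≡ 0
    y₃ rewrite split true 2 | q⁺ | expo-zeros-suc true 1 xs = refl
    adm : admissible (xs ++ q ∷ []) σA ≡ true
    adm = trans (cong (admissible (xs ++ q ∷ [])) σA≡) (admissible-zeros-one xs q inc)

  FP-A-positive : ∀ a Q q → a ℤ.< + 0 → All Pos Q → length Q ≡ suc m → Pos q → RIncreasing (a ∷ Q) →
    1 ≤ FP (a ∷ Q ++ q ∷ []) α βA
  FP-A-positive a Q q a<0 pos len 0<q inc =
    count-≥1 _ (seqs 3 (length (a ∷ Q ++ q ∷ []))) (subst (λ k → σA ∈ seqs 3 k) (sym length-v) σA∈)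
             (σA-contributes a Q q a<0 pos len 0<q inc)
    where
    length-v : length (a ∷ Q ++ q ∷ []) ≡ 3 + m
    length-v = cong suc (trans (ListP.length-++ Q) (trans (cong (_+ 1) len) (ℕP.+-comm (suc m) 1)))
    σA∈ : σA ∈ seqs 3 (3 + m)
    σA∈ = subst (λ k → σA ∈ seqs 3 k)
            (trans (ListP.length-++ (replicate (2 + m) 0))
                   (trans (cong (_+ 1) (ListP.length-replicate (2 + m))) (ℕP.+-comm (2 + m) 1)))
            (∈-seqs⁺ 3 σA (below3 (2 + m)))
      where
      below3 : ∀ k → All (_< 3) (replicate k 0 ++ 1 ∷ [])
      below3 zero    = s≤s (s≤s z≤n) ∷ []
      below3 (suc k) = s≤s z≤n ∷ below3 k

  σB-sorted : Linked _≤_ σB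
  σB-sorted = zeros-sorted m
    where
    zeros-sorted : ∀ k → Linked _≤_ (replicate (suc k) 0 ++ 1 ∷ 2 ∷ [])
    zeros-sorted zero    = z≤n ∷ s≤s z≤n ∷ [-]
    zeros-sorted (suc k) = z≤n ∷ zeros-sorted k

  contributes-B⇒σB : ∀ w σ → length w ≡ 3 + m → σ ∈ seqs 3 (3 + m) → contributes α βB w σ ≡ true → σ ≡ σB
  contributes-B⇒σB w σ len σ∈ c =
    sorted-unique σ σB (admissible⇒sorted w σ lenσ (proj₁ (contributes-true α βB w σ c))) σB-sorted same
    where
    bounds = ∈-seqs⁻ 3 (3 + m) σ σ∈
    lenσ : length w ≡ length σ
    lenσ = trans len (sym (proj₁ bounds))
    mult : ∀ v → v < 3 → multiplicity v σ ≡ lookupD α v + lookupD βB v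
    mult v v<3 = trans (sym (expo-x+y v w σ lenσ)) (cong₂ _+_ (proj₁ e) (proj₂ e))
      where e = proj₂ (contributes-true α βB w σ c) v v<3
    same : ∀ v → multiplicity v σ ≡ multiplicity v σB
    same 0 = trans (mult 0 (s≤s z≤n)) (sym (multiplicity-zeros (suc m) (1 ∷ 2 ∷ [])))
    same 1 = trans (mult 1 (s≤s (s≤s z≤n))) (sym (multiplicity-suc-zeros 0 (suc m) (1 ∷ 2 ∷ [])))
    same 2 = trans (mult 2 (s≤s (s≤s (s≤s z≤n)))) (sym (multiplicity-suc-zeros 1 (suc m) (1 ∷ 2 ∷ [])))
    same (suc (suc (suc v))) =
      trans (multiplicity-absent _ σ (All.map (λ { i<3 refl → ℕP.<⇒≱ i<3 (s≤s (s≤s (s≤s z≤n))) }) (proj₂ bounds)))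
            (sym (multiplicity-suc-zeros (suc (suc v)) (suc m) (1 ∷ 2 ∷ [])))

  ShapeB : List ℤ → Set
  ShapeB w = ∃ λ P → ∃ λ q → ∃ λ r → w ≡ P ++ q ∷ r ∷ [] × length P ≡ suc m ×
    All (λ a → isNeg a ≡ false) P × RIncreasing P × isNeg q ≡ false × isNeg r ≡ true

  contributes-B⇒shape : ∀ w → length w ≡ 3 + m → contributes α βB w σB ≡ true → ShapeB w
  contributes-B⇒shape w len c with last-two (suc m) w (trans len (cong suc (ℕP.+-comm 2 m)))
  ... | P , q , r , refl , lenP = P , q , r , refl , lenP , P-nonNeg , P-inc , q-nonNeg , r-neg
    where
    zeros = replicate (length P) 0
    σB≡ : σB ≡ zeros ++ 1 ∷ 2 ∷ []
    σB≡ = cong (λ k → replicate k 0 ++ 1 ∷ 2 ∷ []) (sym lenP)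
    exps = proj₂ (contributes-true α βB (P ++ q ∷ r ∷ []) σB c)
    split : ∀ neg v → expo neg v (P ++ q ∷ r ∷ []) σB ≡ expo neg v P zeros + expo neg v (q ∷ r ∷ []) (1 ∷ 2 ∷ [])
    split neg v = trans (cong (expo neg v (P ++ q ∷ r ∷ [])) σB≡)
                        (expo-++ neg v P (q ∷ r ∷ []) zeros (1 ∷ 2 ∷ []) (sym (ListP.length-replicate (length P))))
    P-nonNeg : All (λ a → isNeg a ≡ false) P
    P-nonNeg = expo-zeros-y≡0 P (ℕP.m+n≡0⇒m≡0 _ (trans (sym (split true 0)) (proj₂ (exps 0 (s≤s z≤n)))))
    y₂-qr : expo true 1 (q ∷ r ∷ []) (1 ∷ 2 ∷ []) ≡ 0
    y₂-qr = ℕP.m+n≡0⇒n≡0 (expo true 1 P zeros) (trans (sym (split true 1)) (proj₂ (exps 1 (s≤s (s≤s z≤n)))))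
    y₃-qr : expo true 2 (q ∷ r ∷ []) (1 ∷ 2 ∷ []) ≡ 1
    y₃-qr = trans (sym (cong (_+ expo true 2 (q ∷ r ∷ []) (1 ∷ 2 ∷ [])) (expo-zeros-suc true 1 P)))
                  (trans (sym (split true 2)) (proj₂ (exps 2 (s≤s (s≤s (s≤s z≤n))))))
    q-nonNeg : isNeg q ≡ false
    q-nonNeg with isNeg q | y₂-qr
    ... | false | _ = refl
    r-neg : isNeg r ≡ true
    r-neg with isNeg q | isNeg r | y₃-qr
    ... | _     | true  | _  = refl
    ... | false | false | ()
    ... | true  | false | ()
    P-inc : RIncreasing P
    P-inc = admissible-zeros⇒RIncreasing P (q ∷ r ∷ []) (1 ∷ 2 ∷ [])
              (subst (λ τ → admissible (P ++ q ∷ r ∷ []) τ ≡ true) σB≡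
                     (proj₁ (contributes-true α βB (P ++ q ∷ r ∷ []) σB c)))

-- The injection

frontReversed : List ℤ → List ℤ
frontReversed []      = []
frontReversed (x ∷ r) = x ∷ reverse r

frontReversed-injective : ∀ {v v′} → frontReversed v ≡ frontReversed v′ → v ≡ v′
frontReversed-injective {[]}    {[]}     _  = refl
frontReversed-injective {x ∷ v} {x′ ∷ v′} eq with ListP.∷-injective eq
... | refl , eq′ = cong (x ∷_) (ListP.reverse-injective eq′)

-- Moves the last entry to the front.
rotate : List ℤ → List ℤ
rotate w = frontReversed (reverse w)

rotate-∷ʳ : ∀ xs y → rotate (xs ∷ʳ y) ≡ y ∷ xs
rotate-∷ʳ xs y rewrite ListP.reverse-++ xs (y ∷ []) = cong (y ∷_) (ListP.reverse-involutive xs)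

rotate-injective : ∀ {w w′} → rotate w ≡ rotate w′ → w ≡ w′
rotate-injective eq = ListP.reverse-injective (frontReversed-injective eq)

module Injection (m : ℕ) where

  open Exponents m
  open Witness m using (n; e; high; low; rangeℤ-<-high)

  fA fB : List ℤ → ℕ
  fA w = FP w α βA
  fB w = FP w α βB

  fB≤1 : ∀ w → IsSignedPerm n w → fB w ≤ 1
  fB≤1 w (len , _) = subst (λ k → count (contributes α βB w) (seqs 3 k) ≤ 1) (sym len)
    (count-≤1 (contributes α βB w) σB (seqs 3 (3 + m)) (seqs-unique 3 (3 + m))
              (λ σ σ∈ c → contributes-B⇒σB w σ len σ∈ c))

  rotate-image : ∀ w → IsFC n w → 1 ≤ fB w → IsFC n (rotate w) × 1 ≤ fA (rotate w) × rotate w ≢ e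
  rotate-image w fc@(sp , _) 1≤fB
    with count-≥1⇒witness (contributes α βB w) (seqs 3 (length w)) 1≤fB
  ... | σ , σ∈ , c
    with contributes-B⇒σB w σ (proj₁ sp) (subst (λ k → σ ∈ seqs 3 k) (proj₁ sp) σ∈) c
  ... | refl
    with contributes-B⇒shape w (proj₁ sp) c
  ... | P , q , r , refl , lenP , P-nonNeg , P-rinc , q-nonNeg , r-neg = r∷Q-FC , fA-positive , ≢e
    where
    r<0 = negative-isNeg r-neg
    increasing = shapeB-increasing n P q r fc P-nonNeg P-rinc q-nonNeg r<0
    P-pos = proj₁ increasing
    0<q = proj₁ (proj₂ increasing)
    Q-inc = proj₂ (proj₂ increasing)
    w≡ : P ++ q ∷ r ∷ [] ≡ (P ∷ʳ q) ∷ʳ r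
    w≡ = sym (ListP.++-assoc P (q ∷ []) (r ∷ []))
    w↭ : P ++ q ∷ r ∷ [] ↭ r ∷ P ∷ʳ q
    w↭ = ↭.↭-trans (↭.↭-reflexive w≡) (↭.↭-sym (↭P.∷↭∷ʳ r (P ∷ʳ q)))
    rotate≡ : rotate (P ++ q ∷ r ∷ []) ≡ r ∷ P ∷ʳ q
    rotate≡ = trans (cong rotate w≡) (rotate-∷ʳ (P ∷ʳ q) r)
    r∷Q-FC : IsFC n (rotate (P ++ q ∷ r ∷ []))
    r∷Q-FC = subst (IsFC n) (sym rotate≡)
      (negativeHead-FC n r (P ∷ʳ q) (signedPerm-resp-↭ w↭ sp) r<0 Q-inc (AllP.∷ʳ⁺ P-pos 0<q))
    fA-positive : 1 ≤ fA (rotate (P ++ q ∷ r ∷ []))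
    fA-positive = subst (λ v → 1 ≤ fA v) (sym rotate≡)
      (FP-A-positive r P q r<0 P-pos lenP 0<q (RIncreasing-negativeHead r<0 P-rinc P-pos))
    ≢e : rotate (P ++ q ∷ r ∷ []) ≢ e
    ≢e eq = ℤP.<-asym (+<+ ℕP.≤-refl)
      (Linked-last (rangeℤ 2 m)
        (subst (Linked ℤ._<_) (proj₂ (ListP.∷-injective (trans (sym rotate≡) eq))) Q-inc))

  fA-e : 1 ≤ fA e
  fA-e = subst (λ v → 1 ≤ fA (-[1+ 0 ] ∷ v)) (ListP.++-assoc (rangeℤ 2 m) (high ∷ []) (low ∷ []))
    (FP-A-positive -[1+ 0 ] Q low -<+ Q-pos Q-length (+<+ (s≤s z≤n))
      (RIncreasing-negativeHead -<+ (increasing-positive⇒RIncreasing Q-inc Q-pos) Q-pos))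
    where
    Q = rangeℤ 2 m ∷ʳ high
    Q-pos : All Pos Q
    Q-pos = AllP.∷ʳ⁺ (rangeℤ-positive 1 m) (+<+ (s≤s z≤n))
    Q-inc : Linked ℤ._<_ Q
    Q-inc = Linked-∷ʳ (rangeℤ-increasing 2 m) rangeℤ-<-high
    Q-length : length Q ≡ suc m
    Q-length = trans (ListP.length-++ (rangeℤ 2 m)) (trans (cong (_+ 1) (length-rangeℤ 2 m)) (ℕP.+-comm m 1))

proposition8p8 : ∀ (n : ℕ) → 2 < n → (L : List (List ℤ)) → EnumeratesFC n L →
  ¬ PoirierSchurPositive L
proposition8p8 (suc (suc (suc m))) _ L (unique , enum) (_ , symmetricY , _) =
  ℕP.<-irrefl (sym (symmetricY α βA βB βA↭βB))
    (sum-<-by-injection fB fA rotate e L unique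
      (λ w w∈L → fB≤1 w (proj₁ (FC w∈L)))
      rotate-injective
      (λ w w∈L 1≤fB → let fc , 1≤fA , ≢e = rotate-image w (FC w∈L) 1≤fB in ∈L fc , 1≤fA , ≢e)
      (∈L e-FC) fA-e)
  where
  open Exponents m using (α; βA; βB; βA↭βB)
  open Witness m using (e; e-FC)
  open Injection m
  FC : ∀ {w} → w ∈ L → IsFC (3 + m) w
  FC {w} = Equivalence.to (enum w)
  ∈L : ∀ {w} → IsFC (3 + m) w → w ∈ L
  ∈L {w} = Equivalence.from (enum w)
proposition8p8 (suc zero)       (s≤s ())
proposition8p8 (suc (suc zero)) (s≤s (s≤s ()))
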